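{- Let $G$ be a disconnected finite simple graph, $k$ a positive even integer, and suppose there are $0<\alpha_1<\alpha_2<\cdots<\alpha_k<1$ such that the values $\beta_i=\operatorname{N}(G;\alpha_i)$ satisfy $0<\beta_1$ and the alternating pattern $\beta_1>\beta_2<\beta_3>\beta_4<\cdots>\beta_k$, i.e. for $1\le i\le k-1$, $\beta_i>\beta_{i+1}$ if $i$ is odd and $\beta_i<\beta_{i+1}$ if $i$ is even. Then there exist a positive integer $l$ and numbers $0<\alpha_1'<\alpha_2'<\cdots<\alpha_k'<\alpha_{k+1}'<1$ such that, writing $H=G[K_l]+K_1$ and $\beta_i'=\operatorname{N}(H;\alpha_i')$ for $1\le i\le k+1$, we have $0<\beta_1'>\beta_2'<\beta_3'>\beta_4'<\cdots>\beta_k'<\beta_{k+1}'$, i.e. $\beta_1'>0$ and for $1\le i\le k$, $\beta_i'>\beta_{i+1}'$ if $i$ is odd and $\beta_i'<\beta_{i+1}'$ if $i$ is even.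
   Context: For a finite simple graph $G$, the node reliability $\operatorname{N}(G;p)$ is the probability that, when each vertex of $G$ is independently operational with probability $p\in[0,1]$ (edges being perfectly reliable), the set of operational vertices is nonempty and induces a connected subgraph of $G$. For a positive integer $l$, $G[K_l]$ denotes the lexicographic product of $G$ with $K_l$: the graph obtained from $G$ by replacing each vertex $v$ by a complete graph $K_l^v$ on $l$ vertices, where two vertices in $K_l^u$ and $K_l^v$ with $u\neq v$ are adjacent iff $uv$ is an edge of $G$, and all vertices within the same $K_l^v$ are adjacent. For a graph $F$, $F+K_1$ denotes the graph obtained from $F$ by adding one new vertex adjacent to every vertex of $F$.
   Formalization: The numbers $\alpha_i$ are rational, and the numbers $\alpha_i'$ produced by the conclusion are likewise taken in ℚ. -}

module Defs where

open import Data.Bool using (Bool; true; false; _∧_; _∨_; not; if_then_else_; T)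
open import Data.Nat as ℕ using (ℕ; zero; suc)
open import Data.Nat.Divisibility using (_∣_)
open import Data.Fin as Fin using (Fin; zero; suc; remQuot; toℕ)
open import Data.Fin.Properties using (_≟_)
open import Data.Product using (_×_; _,_; proj₁; proj₂)
open import Data.Vec using (Vec; []; _∷_; lookup)
open import Data.List using (List; []; _∷_; map; _++_; foldr)
open import Data.Rational using (ℚ; 0ℚ; 1ℚ; _+_; _*_; _-_; _<_)
open import Relation.Nullary.Decidable using (⌊_⌋; yes; no)
open import Data.Empty using (⊥; ⊥-elim)
open import Relation.Binary.PropositionalEquality using (_≡_; refl) renaming (sym to ≡-sym)

record Graph (n : ℕ) : Set where
  field
    adj     : Fin n → Fin n → Bool
    sym     : ∀ u v → adj u v ≡ adj v u
    irrefl  : ∀ u → adj u u ≡ false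
open Graph public

Subset : ℕ → Set
Subset n = Vec Bool n

allSubsets : (n : ℕ) → List (Subset n)
allSubsets zero    = [] ∷ []
allSubsets (suc n) = map (false ∷_) (allSubsets n) ++ map (true ∷_) (allSubsets n)

anyFin : ∀ {n} → (Fin n → Bool) → Bool
anyFin {zero}  f = false
anyFin {suc n} f = f zero ∨ anyFin (λ i → f (suc i))

allFin : ∀ {n} → (Fin n → Bool) → Bool
allFin {zero}  f = true
allFin {suc n} f = f zero ∧ allFin (λ i → f (suc i))

step : ∀ {n} → Graph n → Subset n → (Fin n → Bool) → (Fin n → Bool)
step G S R v = R v ∨ (lookup S v ∧ anyFin (λ u → R u ∧ adj G u v))

iter : ∀ {A : Set} → ℕ → (A → A) → A → A
iter zero    f x = x
iter (suc t) f x = f (iter t f x)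

-- vertices of S reachable from s by a walk inside S (n steps suffice)
reach : ∀ {n} → Graph n → Subset n → Fin n → (Fin n → Bool)
reach {n} G S s = iter n (step G S) (λ v → ⌊ v ≟ s ⌋)

-- G[S] is connected and S is nonempty:
-- some vertex s of S reaches every vertex of S by walks inside S
connectedInduced : ∀ {n} → Graph n → Subset n → Bool
connectedInduced G S =
  anyFin (λ s → lookup S s ∧ allFin (λ v → not (lookup S v) ∨ reach G S s v))

full : ∀ n → Subset n
full zero    = []
full (suc n) = true ∷ full n

-- G is connected (with at least one vertex)
Connected : ∀ {n} → Graph n → Set
Connected G = T (connectedInduced G (full _))

Disconnected : ∀ {n} → Graph n → Set
Disconnected G = Connected G → ⊥

_^_ : ℚ → ℕ → ℚ
x ^ zero  = 1ℚ
x ^ suc k = x * (x ^ k)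

weight : ∀ {n} → ℚ → Subset n → ℚ
weight p []          = 1ℚ
weight p (true  ∷ S) = p * weight p S
weight p (false ∷ S) = (1ℚ - p) * weight p S

nodeRel : ∀ {n} → Graph n → ℚ → ℚ
nodeRel {n} G p =
  foldr (λ S acc → (if connectedInduced G S then weight p S else 0ℚ) + acc)
        0ℚ (allSubsets n)

-- Lexicographic product G[K_l] on Fin (n * l); vertex i ↦ (remQuot l i) = (v, j)

lexPairAdj : ∀ {n l} → Graph n → Fin n × Fin l → Fin n × Fin l → Bool
lexPairAdj G (u , i) (v , j) = if ⌊ u ≟ v ⌋ then not ⌊ i ≟ j ⌋ else adj G u v

lexPairSym : ∀ {n l} (G : Graph n) (x y : Fin n × Fin l) → lexPairAdj G x y ≡ lexPairAdj G y x
lexPairSym G (u , i) (v , j) with u ≟ v | v ≟ u | i ≟ j | j ≟ i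
... | yes _ | yes _ | yes _ | yes _ = refl
... | yes _ | yes _ | no _  | no _  = refl
... | yes _ | yes _ | yes p | no q  = ⊥-elim (q (≡-sym p))
... | yes _ | yes _ | no q  | yes p = ⊥-elim (q (≡-sym p))
... | no _  | no _  | _ | _ = Graph.sym G u v
... | yes p | no q  | _ | _ = ⊥-elim (q (≡-sym p))
... | no q  | yes p | _ | _ = ⊥-elim (q (≡-sym p))

lexPairIrr : ∀ {n l} (G : Graph n) (x : Fin n × Fin l) → lexPairAdj G x x ≡ false
lexPairIrr G (u , i) with u ≟ u | i ≟ i
... | yes _ | yes _ = refl
... | yes _ | no q  = ⊥-elim (q refl)
... | no q  | _     = ⊥-elim (q refl)

lexK : ∀ {n} → Graph n → (l : ℕ) → Graph (n ℕ.* l)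
lexK {n} G l = record
  { adj    = λ x y → lexPairAdj G (remQuot {n} l x) (remQuot {n} l y)
  ; sym    = λ x y → lexPairSym G (remQuot {n} l x) (remQuot {n} l y)
  ; irrefl = λ x → lexPairIrr G (remQuot {n} l x)
  }

coneK1 : ∀ {n} → Graph n → Graph (suc n)
coneK1 {n} F = record { adj = a ; sym = sy ; irrefl = ir }
  where
  a : Fin (suc n) → Fin (suc n) → Bool
  a zero    zero    = false
  a zero    (suc v) = true
  a (suc u) zero    = true
  a (suc u) (suc v) = adj F u v
  sy : ∀ x y → a x y ≡ a y x
  sy zero zero = refl
  sy zero (suc v) = refl
  sy (suc u) zero = refl
  sy (suc u) (suc v) = Graph.sym F u v
  ir : ∀ x → a x x ≡ false
  ir zero = refl
  ir (suc u) = Graph.irrefl F u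

-- Sequences indexed by ℕ, only the first k entries (indices 0..k-1) matter.

IncreasingIn01 : ℕ → (ℕ → ℚ) → Set
IncreasingIn01 k α =
  (0ℚ < α 0) × (∀ i → suc i ℕ.< k → α i < α (suc i)) × (∀ i → suc i ≡ k → α i < 1ℚ)

-- 0-indexed: β_i > β_{i+1} if i even (paper's index i+1 odd), β_i < β_{i+1} if i odd
isEven : ℕ → Bool
isEven zero          = true
isEven (suc zero)    = false
isEven (suc (suc i)) = isEven i

Alternating : ℕ → (ℕ → ℚ) → Set
Alternating k β =
  (0ℚ < β 0) ×
  (∀ i → suc i ℕ.< k → if isEven i then β (suc i) < β i else β i < β (suc i))

-- Writing H = G[K_l] + K_1, conditioning on the apex and grouping the vertices of G[K_l] into blocks gives
-- N(H; p) = p + (1 - p) N(G; 1 - (1 - p)^l).  For l large, pick small p_i at which 1 - (1 - p_i)^l lies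
-- just above α_i: then N(H; p_i) differs from β_i by at most p_i plus a Lipschitz error, so the alternation
-- of the β_i survives.  As k is even the new pattern must end with an increase, and since N(H; p_k) < 1
-- while N(H; r) ≥ r, any r between N(H; p_k) and 1 provides it.

module Submission where

module Connectivity where

  open import Defs hiding (sym)
  open import Data.Bool using (Bool; true; false; _∨_; not; T)
  open import Data.Bool.Properties using (T-≡; T-∧; T-∨)
  import Data.Nat as ℕ
  open import Data.Nat using (ℕ; zero; suc; _≤_; _<_; _≤′_; ≤′-refl; ≤′-step; z≤n)
  open import Data.Nat.Properties using (≤-refl; ≤-trans; ≤-<-trans; m<n⇒m<1+n; ≤-pred; ≤⇒≤′; <-irrefl)
  open import Data.Fin using (Fin; zero; suc; combine; remQuot; quotient)
  open import Data.Fin.Properties using (_≟_; remQuot-combine; combine-remQuot)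
  import Data.Fin.Subset as Sub
  open import Data.Fin.Subset.Properties using (_∈?_; _⊂?_; p⊂q⇒∣p∣<∣q∣; ∣p∣≤n)
  open import Data.Product using (∃; _×_; _,_; proj₁; proj₂; uncurry)
  open import Data.Sum using (_⊎_; inj₁; inj₂)
  open import Data.Unit using (tt)
  open import Data.Empty using (⊥; ⊥-elim)
  open import Data.Vec using (lookup; tabulate; _∷_)
  open import Data.Vec.Properties using (lookup∘tabulate; []=⇒lookup; lookup⇒[]=)
  open import Function using (_∘_; _⇔_; mk⇔; Equivalence)
  open import Level using (0ℓ)
  open import Relation.Nullary using (yes; no; ¬_)
  open import Relation.Nullary.Decidable using (⌊_⌋; toWitness; fromWitness)
  open import Relation.Unary using (Pred)
  open import Relation.Binary.PropositionalEquality using (_≡_; refl; sym; trans; cong; cong₂; subst)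

  open Equivalence using (to; from)

  T-injective : ∀ {a b} → (T a → T b) → (T b → T a) → a ≡ b
  T-injective {false} {false} _ _ = refl
  T-injective {false} {true}  _ g = ⊥-elim (g tt)
  T-injective {true}  {false} f _ = ⊥-elim (f tt)
  T-injective {true}  {true}  _ _ = refl

  T-⇒ : ∀ {a b} → T (not a ∨ b) ⇔ (T a → T b)
  T-⇒ {false} = mk⇔ (λ _ ()) (λ _ → tt)
  T-⇒ {true}  = mk⇔ (λ t _ → t) (λ f → f tt)

  anyFin⁺ : ∀ {n} (f : Fin n → Bool) i → T (f i) → T (anyFin f)
  anyFin⁺ f zero    t = from (T-∨ {f zero}) (inj₁ t)
  anyFin⁺ f (suc i) t = from (T-∨ {f zero}) (inj₂ (anyFin⁺ (f ∘ suc) i t))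

  anyFin⁻ : ∀ {n} (f : Fin n → Bool) → T (anyFin f) → ∃ λ i → T (f i)
  anyFin⁻ {suc n} f t with to (T-∨ {f zero}) t
  ... | inj₁ t₀ = zero , t₀
  ... | inj₂ t′ with anyFin⁻ (f ∘ suc) t′
  ...   | i , tᵢ = suc i , tᵢ

  anyFin-cong : ∀ {n} {f g : Fin n → Bool} → (∀ i → f i ≡ g i) → anyFin f ≡ anyFin g
  anyFin-cong {zero}  f≗g = refl
  anyFin-cong {suc n} f≗g = cong₂ _∨_ (f≗g zero) (anyFin-cong (f≗g ∘ suc))

  allFin⁺ : ∀ {n} (f : Fin n → Bool) → (∀ i → T (f i)) → T (allFin f)
  allFin⁺ {zero}  f h = tt
  allFin⁺ {suc n} f h = from (T-∧ {f zero}) (h zero , allFin⁺ (f ∘ suc) (h ∘ suc))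

  allFin⁻ : ∀ {n} (f : Fin n → Bool) → T (allFin f) → ∀ i → T (f i)
  allFin⁻ f t zero    = proj₁ (to (T-∧ {f zero}) t)
  allFin⁻ f t (suc i) = allFin⁻ (f ∘ suc) (proj₂ (to (T-∧ {f zero}) t)) i

  ∈-tabulate⁺ : ∀ {n} {f : Fin n → Bool} {x} → T (f x) → x Sub.∈ tabulate f
  ∈-tabulate⁺ {f = f} {x} t = lookup⇒[]= x _ (trans (lookup∘tabulate f x) (to T-≡ t))

  ∈-tabulate⁻ : ∀ {n} {f : Fin n → Bool} {x} → x Sub.∈ tabulate f → T (f x)
  ∈-tabulate⁻ {f = f} {x} x∈ = from T-≡ (trans (sym (lookup∘tabulate f x)) ([]=⇒lookup x∈))

  ⊆∧⊄⇒⊇ : ∀ {n} {p q : Sub.Subset n} → p Sub.⊆ q → ¬ (p Sub.⊂ q) → q Sub.⊆ p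
  ⊆∧⊄⇒⊇ {p = p} p⊆q p⊄q {x} x∈q with x ∈? p
  ... | yes x∈p = x∈p
  ... | no x∉p  = ⊥-elim (p⊄q (p⊆q , x , x∈q , x∉p))

  Closed : ∀ {n} → Graph n → Subset n → Pred (Fin n) 0ℓ → Set
  Closed G S C = ∀ {u v} → C u → T (lookup S v) → T (adj G u v) → C v

  -- S is nonempty and G[S] is connected: some s ∈ S lies in no S-closed set missing a vertex of S.
  InducesConnected : ∀ {n} → Graph n → Subset n → Set₁
  InducesConnected G S =
    ∃ λ s → T (lookup S s) × (∀ C → Closed G S C → C s → ∀ {v} → T (lookup S v) → C v)

  module _ {n} (G : Graph n) (S : Subset n) where

    step-inflationary : ∀ {R v} → T (R v) → T (step G S R v)
    step-inflationary {R} {v} t = from (T-∨ {R v}) (inj₁ t)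

    step⁺ : ∀ {R u v} → T (R u) → T (lookup S v) → T (adj G u v) → T (step G S R v)
    step⁺ {R} {u} {v} r s a =
      from (T-∨ {R v}) (inj₂ (from (T-∧ {lookup S v}) (s , anyFin⁺ _ u (from (T-∧ {R u}) (r , a)))))

    step⁻ : ∀ {R v} → T (step G S R v) →
            T (R v) ⊎ (T (lookup S v) × ∃ λ u → T (R u) × T (adj G u v))
    step⁻ {R} {v} t with to (T-∨ {R v}) t
    ... | inj₁ r = inj₁ r
    ... | inj₂ t′ with to (T-∧ {lookup S v}) t′
    ...   | s , t″ with anyFin⁻ _ t″
    ...     | u , ra = inj₂ (s , u , to (T-∧ {R u}) ra)

    module Reach (s : Fin n) where

      R : ℕ → Fin n → Bool
      R t = iter t (step G S) (λ v → ⌊ v ≟ s ⌋)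

      R-least : ∀ C → Closed G S C → C s → ∀ t {v} → T (R t v) → C v
      R-least C closed Cs zero {v} r with toWitness {a? = v ≟ s} r
      ... | refl = Cs
      R-least C closed Cs (suc t) r with step⁻ r
      ... | inj₁ r′ = R-least C closed Cs t r′
      ... | inj₂ (v∈S , u , r′ , a) = closed (R-least C closed Cs t r′) v∈S a

      Stable : ℕ → Set
      Stable t = ∀ {v} → T (R (suc t) v) → T (R t v)

      stable-suc : ∀ {t} → Stable t → Stable (suc t)
      stable-suc st r with step⁻ r
      ... | inj₁ r′ = r′
      ... | inj₂ (v∈S , u , r′ , a) = step⁺ (st r′) v∈S a

      stable-≤′ : ∀ {t u} → t ≤′ u → Stable t → Stable u
      stable-≤′ ≤′-refl       st = st
      stable-≤′ {u = suc u} (≤′-step t≤u) st = stable-suc {u} (stable-≤′ t≤u st)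

      Rs : ℕ → Sub.Subset n
      Rs t = tabulate (R t)

      grows-or-stable : ∀ t → Rs t Sub.⊂ Rs (suc t) ⊎ Stable t
      grows-or-stable t with Rs t ⊂? Rs (suc t)
      ... | yes grows = inj₁ grows
      ... | no ¬grows = inj₂ λ r → ∈-tabulate⁻ (⊆∧⊄⇒⊇ inflationary ¬grows (∈-tabulate⁺ r))
        where
        inflationary : Rs t Sub.⊆ Rs (suc t)
        inflationary m = ∈-tabulate⁺ (step-inflationary (∈-tabulate⁻ m))

      -- Every non-stable step adds a vertex, which can happen at most n times.
      stable-or-large : ∀ t → (∃ λ t′ → t′ < t × Stable t′) ⊎ t ≤ Sub.∣ Rs t ∣
      stable-or-large zero = inj₂ z≤n
      stable-or-large (suc t) with stable-or-large t
      ... | inj₁ (t′ , t′<t , st) = inj₁ (t′ , m<n⇒m<1+n t′<t , st)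
      ... | inj₂ t≤∣Rt∣ with grows-or-stable t
      ...   | inj₁ grows = inj₂ (≤-<-trans t≤∣Rt∣ (p⊂q⇒∣p∣<∣q∣ grows))
      ...   | inj₂ st    = inj₁ (t , ≤-refl , st)

      stable-n : Stable n
      stable-n with stable-or-large (suc n)
      ... | inj₁ (t , t<1+n , st) = stable-≤′ (≤⇒≤′ (≤-pred t<1+n)) st
      ... | inj₂ 1+n≤∣Rs∣         = ⊥-elim (<-irrefl refl (≤-trans 1+n≤∣Rs∣ (∣p∣≤n (Rs (suc n)))))

    reach-closed : ∀ s → Closed G S (T ∘ reach G S s)
    reach-closed s r v∈S a = Reach.stable-n s (step⁺ r v∈S a)

    reach-least : ∀ s C → Closed G S C → C s → ∀ {v} → T (reach G S s v) → C v
    reach-least s C closed Cs = Reach.R-least s C closed Cs n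

    s∈reach : ∀ s → T (reach G S s s)
    s∈reach s = iter-inflationary n (fromWitness refl)
      where
      iter-inflationary : ∀ t {R} → T (R s) → T (iter t (step G S) R s)
      iter-inflationary zero    r = r
      iter-inflationary (suc t) r = step-inflationary (iter-inflationary t r)

  connectedInduced⇔ : ∀ {n} (G : Graph n) S → T (connectedInduced G S) ⇔ InducesConnected G S
  connectedInduced⇔ G S = mk⇔ ⇒ ⇐
    where
    ⇒ : T (connectedInduced G S) → InducesConnected G S
    ⇒ t with anyFin⁻ _ t
    ... | s , t′ with to (T-∧ {lookup S s}) t′
    ...   | s∈S , all = s , s∈S , λ C closed Cs {v} v∈S →
                  reach-least G S s C closed Cs (to T-⇒ (allFin⁻ _ all v) v∈S)
    ⇐ : InducesConnected G S → T (connectedInduced G S)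
    ⇐ (s , s∈S , least) = anyFin⁺ _ s (from (T-∧ {lookup S s}) (s∈S , allFin⁺ _ λ v →
          from (T-⇒ {lookup S v}) (least (T ∘ reach G S s) (reach-closed G S s) (s∈reach G S s))))

  connectedInduced-≡ : ∀ {n m} (G : Graph n) (H : Graph m) S S′ →
                       (InducesConnected G S → InducesConnected H S′) →
                       (InducesConnected H S′ → InducesConnected G S) →
                       connectedInduced G S ≡ connectedInduced H S′
  connectedInduced-≡ G H S S′ f g = T-injective
    (from (connectedInduced⇔ H S′) ∘ f ∘ to (connectedInduced⇔ G S))
    (from (connectedInduced⇔ G S) ∘ g ∘ to (connectedInduced⇔ H S′))

  coneK1-apex-connected : ∀ {n} (F : Graph n) S → T (connectedInduced (coneK1 F) (true ∷ S))
  coneK1-apex-connected F S = from (connectedInduced⇔ (coneK1 F) (true ∷ S)) (zero , tt , least)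
    where
    least : ∀ C → Closed (coneK1 F) (true ∷ S) C → C zero → ∀ {v} → T (lookup (true ∷ S) v) → C v
    least C closed C₀ {zero}  _   = C₀
    least C closed C₀ {suc v} v∈S = closed C₀ v∈S tt

  coneK1-connected-without-apex : ∀ {n} (F : Graph n) S →
                                  connectedInduced (coneK1 F) (false ∷ S) ≡ connectedInduced F S
  coneK1-connected-without-apex {n} F S = connectedInduced-≡ (coneK1 F) F (false ∷ S) S ⇒ ⇐
    where
    ⇒ : InducesConnected (coneK1 F) (false ∷ S) → InducesConnected F S
    ⇒ (suc s , s∈S , least) = s , s∈S , λ C closed Cs {v} v∈S →
      least (lift C) (λ {u} {v} → lift-closed C closed {u} {v}) Cs {suc v} v∈S
      where
      lift : Pred (Fin n) 0ℓ → Pred (Fin (suc n)) 0ℓ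
      lift C zero    = ⊥
      lift C (suc u) = C u
      lift-closed : ∀ C → Closed F S C → Closed (coneK1 F) (false ∷ S) (lift C)
      lift-closed C closed {zero}  {_}     ()
      lift-closed C closed {suc u} {zero}  Cu ()
      lift-closed C closed {suc u} {suc v} Cu v∈S a = closed Cu v∈S a
    ⇐ : InducesConnected F S → InducesConnected (coneK1 F) (false ∷ S)
    ⇐ (s , s∈S , least) = suc s , s∈S , least′
      where
      least′ : ∀ C → Closed (coneK1 F) (false ∷ S) C → C (suc s) → ∀ {v} → T (lookup (false ∷ S) v) → C v
      least′ C closed Cs {suc v} v∈S = least (C ∘ suc) closed Cs v∈S

  occupiedBlocks : ∀ {n} l → Subset (n ℕ.* l) → Subset n
  occupiedBlocks {n} l S = tabulate λ v → anyFin λ j → lookup S (combine {n} {l} v j)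

  module _ {n} (G : Graph n) (l : ℕ) (S : Subset (n ℕ.* l)) where

    private
      S′ : Subset n
      S′ = occupiedBlocks {n} l S

    occupied⁺ : ∀ u i → T (lookup S (combine u i)) → T (lookup S′ u)
    occupied⁺ u i x = subst T (sym (lookup∘tabulate _ u)) (anyFin⁺ _ i x)

    occupied⁻ : ∀ u → T (lookup S′ u) → ∃ λ i → T (lookup S (combine u i))
    occupied⁻ u x = anyFin⁻ _ (subst T (lookup∘tabulate _ u) x)

    lexK-adj : ∀ u i w j → adj (lexK G l) (combine u i) (combine w j) ≡ lexPairAdj G (u , i) (w , j)
    lexK-adj u i w j = cong₂ (lexPairAdj G) (remQuot-combine u i) (remQuot-combine w j)

    lexK-adj-block : ∀ u {i j} → ¬ i ≡ j → T (adj (lexK G l) (combine u i) (combine u j))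
    lexK-adj-block u {i} {j} i≢j rewrite lexK-adj u i u j with u ≟ u | i ≟ j
    ... | yes _ | yes i≡j = i≢j i≡j
    ... | yes _ | no _    = tt
    ... | no u≢u | _      = ⊥-elim (u≢u refl)

    lexK-adj-between : ∀ {u w} i j → T (adj G u w) → T (adj (lexK G l) (combine u i) (combine w j))
    lexK-adj-between {u} {w} i j a rewrite lexK-adj u i w j with u ≟ w
    ... | yes refl = ⊥-elim (subst T (irrefl G u) a)
    ... | no _     = a

    lexK-adj⁻ : ∀ {x y} → T (adj (lexK G l) x y) →
                quotient l x ≡ quotient l y ⊎ T (adj G (quotient l x) (quotient l y))
    lexK-adj⁻ {x} {y} a with quotient {n} l x ≟ quotient l y
    ... | yes same = inj₁ same
    ... | no _     = inj₂ a

    ∈-combine-remQuot : ∀ {x} → T (lookup S x) → T (lookup S (uncurry combine (remQuot {n} l x)))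
    ∈-combine-remQuot {x} = subst (T ∘ lookup S) (sym (combine-remQuot {n} l x))

    lexK-connected : connectedInduced (lexK G l) S ≡ connectedInduced G S′
    lexK-connected = connectedInduced-≡ (lexK G l) G S S′ ⇒ ⇐
      where
      ⇒ : InducesConnected (lexK G l) S → InducesConnected G S′
      ⇒ (s , s∈S , least) = quotient l s , occupied⁺ (quotient l s) _ (∈-combine-remQuot s∈S) , least′
        where
        least′ : ∀ C → Closed G S′ C → C (quotient l s) → ∀ {v} → T (lookup S′ v) → C v
        least′ C closed Cs {v} v∈S′ with occupied⁻ v v∈S′
        ... | i , x∈S = subst C (cong proj₁ (remQuot-combine v i)) (least (C ∘ quotient l) closed′ Cs x∈S)
          where
          closed′ : Closed (lexK G l) S (C ∘ quotient l)
          closed′ Cx y∈S a with lexK-adj⁻ a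
          ... | inj₁ same = subst C same Cx
          ... | inj₂ a′   = closed Cx (occupied⁺ _ _ (∈-combine-remQuot y∈S)) a′
      ⇐ : InducesConnected G S′ → InducesConnected (lexK G l) S
      ⇐ (v₀ , v₀∈S′ , least) with occupied⁻ v₀ v₀∈S′
      ... | j₀ , s∈S = combine v₀ j₀ , s∈S , least′
        where
        least′ : ∀ C → Closed (lexK G l) S C → C (combine v₀ j₀) → ∀ {x} → T (lookup S x) → C x
        least′ C closed Cs {x} x∈S =
          subst C (combine-remQuot {n} l x) (proj₂ (least Full Full-closed (spread s∈S Cs) (occupied⁺ _ _ x∈S′)) _ x∈S′)
          where
          x∈S′ : T (lookup S (uncurry combine (remQuot {n} l x)))
          x∈S′ = ∈-combine-remQuot x∈S
          Full : Pred (Fin n) 0ℓ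
          Full u = (∃ λ i → T (lookup S (combine u i))) × (∀ i → T (lookup S (combine u i)) → C (combine u i))
          spread : ∀ {u i} → T (lookup S (combine u i)) → C (combine u i) → Full u
          spread {u} {i} y Cy = (i , y) , fill
            where
            fill : ∀ j → T (lookup S (combine u j)) → C (combine u j)
            fill j z with i ≟ j
            ... | yes refl = Cy
            ... | no i≢j   = closed Cy z (lexK-adj-block u i≢j)
          Full-closed : Closed G S′ Full
          Full-closed {v = w} ((i , y) , all) w∈S′ a with occupied⁻ w w∈S′
          ... | j , z = spread z (closed (all i y) z (lexK-adj-between i j a))

module ReliabilityFormulas where

  open import Defs hiding (sym)
  open Connectivity
  open import Data.Bool using (Bool; true; false; if_then_else_; T)
  open import Data.Nat as ℕ using (ℕ; zero; suc)
  open import Data.Fin using (combine)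
  open import Data.List using (List; []; _∷_; map; _++_; foldr)
  open import Data.Vec as Vec using ([]; _∷_; lookup)
  open import Data.Vec.Properties using (lookup-++ˡ; lookup-++ʳ; tabulate-cong)
  open import Data.Rational using (ℚ; 0ℚ; 1ℚ; _+_; _*_; _-_)
  open import Data.Rational.Properties
    using (+-identityˡ; +-identityʳ; +-assoc; *-assoc; *-comm; *-zeroˡ; *-zeroʳ; *-identityˡ; *-distribˡ-+)
  open import Data.Rational.Solver using (module +-*-Solver)
  open import Function using (_∘_)
  open import Relation.Binary.PropositionalEquality using (_≡_; refl; sym; trans; cong; cong₂; module ≡-Reasoning)
  open ≡-Reasoning
  open +-*-Solver

  sumOver : ∀ {A : Set} → List A → (A → ℚ) → ℚ
  sumOver xs f = foldr (λ x acc → f x + acc) 0ℚ xs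

  module _ {A : Set} where

    sumOver-++ : ∀ (xs ys : List A) f → sumOver (xs ++ ys) f ≡ sumOver xs f + sumOver ys f
    sumOver-++ []       ys f = sym (+-identityˡ _)
    sumOver-++ (x ∷ xs) ys f = trans (cong (f x +_) (sumOver-++ xs ys f)) (sym (+-assoc (f x) _ _))

    sumOver-map : ∀ {B : Set} (g : A → B) xs f → sumOver (map g xs) f ≡ sumOver xs (f ∘ g)
    sumOver-map g []       f = refl
    sumOver-map g (x ∷ xs) f = cong (f (g x) +_) (sumOver-map g xs f)

    sumOver-cong : ∀ (xs : List A) {f g} → (∀ x → f x ≡ g x) → sumOver xs f ≡ sumOver xs g
    sumOver-cong []       f≗g = refl
    sumOver-cong (x ∷ xs) f≗g = cong₂ _+_ (f≗g x) (sumOver-cong xs f≗g)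

    sumOver-*ˡ : ∀ (xs : List A) c f → sumOver xs (λ x → c * f x) ≡ c * sumOver xs f
    sumOver-*ˡ []       c f = sym (*-zeroʳ c)
    sumOver-*ˡ (x ∷ xs) c f = trans (cong (c * f x +_) (sumOver-*ˡ xs c f)) (sym (*-distribˡ-+ c (f x) _))

  subsetSum : ∀ n → (Subset n → ℚ) → ℚ
  subsetSum n = sumOver (allSubsets n)

  subsetSum-cong : ∀ n {f g} → (∀ S → f S ≡ g S) → subsetSum n f ≡ subsetSum n g
  subsetSum-cong n = sumOver-cong (allSubsets n)

  subsetSum-*ˡ : ∀ n c f → subsetSum n (λ S → c * f S) ≡ c * subsetSum n f
  subsetSum-*ˡ n = sumOver-*ˡ (allSubsets n)

  subsetSum-suc : ∀ n f → subsetSum (suc n) f ≡ subsetSum n (f ∘ (false ∷_)) + subsetSum n (f ∘ (true ∷_))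
  subsetSum-suc n f = trans (sumOver-++ (map (false ∷_) (allSubsets n)) _ f)
    (cong₂ _+_ (sumOver-map (false ∷_) (allSubsets n) f) (sumOver-map (true ∷_) (allSubsets n) f))

  subsetSum-++ : ∀ a b f → subsetSum (a ℕ.+ b) f ≡ subsetSum a (λ A → subsetSum b (λ B → f (A Vec.++ B)))
  subsetSum-++ zero    b f = sym (+-identityʳ _)
  subsetSum-++ (suc a) b f = begin
    subsetSum (suc a ℕ.+ b) f
      ≡⟨ subsetSum-suc (a ℕ.+ b) f ⟩
    subsetSum (a ℕ.+ b) (f ∘ (false ∷_)) + subsetSum (a ℕ.+ b) (f ∘ (true ∷_))
      ≡⟨ cong₂ _+_ (subsetSum-++ a b (f ∘ (false ∷_))) (subsetSum-++ a b (f ∘ (true ∷_))) ⟩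
    subsetSum a (λ A → subsetSum b (λ B → f (false ∷ A Vec.++ B)))
      + subsetSum a (λ A → subsetSum b (λ B → f (true ∷ A Vec.++ B)))
      ≡⟨ sym (subsetSum-suc a (λ A → subsetSum b (λ B → f (A Vec.++ B)))) ⟩
    subsetSum (suc a) (λ A → subsetSum b (λ B → f (A Vec.++ B))) ∎

  weight-++ : ∀ p {a b} (A : Subset a) (B : Subset b) → weight p (A Vec.++ B) ≡ weight p A * weight p B
  weight-++ p []          B = sym (*-identityˡ _)
  weight-++ p (true  ∷ A) B = trans (cong (p *_) (weight-++ p A B)) (sym (*-assoc p _ _))
  weight-++ p (false ∷ A) B = trans (cong ((1ℚ - p) *_) (weight-++ p A B)) (sym (*-assoc (1ℚ - p) _ _))

  subsetSum-weight : ∀ p n → subsetSum n (weight p) ≡ 1ℚ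
  subsetSum-weight p zero    = refl
  subsetSum-weight p (suc n) = begin
    subsetSum (suc n) (weight p)
      ≡⟨ subsetSum-suc n (weight p) ⟩
    subsetSum n (λ S → (1ℚ - p) * weight p S) + subsetSum n (λ S → p * weight p S)
      ≡⟨ cong₂ _+_ (subsetSum-*ˡ n (1ℚ - p) (weight p)) (subsetSum-*ˡ n p (weight p)) ⟩
    (1ℚ - p) * subsetSum n (weight p) + p * subsetSum n (weight p)
      ≡⟨ cong (λ z → (1ℚ - p) * z + p * z) (subsetSum-weight p n) ⟩
    (1ℚ - p) * 1ℚ + p * 1ℚ
      ≡⟨ solve 1 (λ p → (con 1ℚ :- p) :* con 1ℚ :+ p :* con 1ℚ := con 1ℚ) refl p ⟩
    1ℚ ∎

  -- The probability that at least one of l independent vertices operates.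
  blockProb : ℕ → ℚ → ℚ
  blockProb l p = 1ℚ - (1ℚ - p) ^ l

  subsetSum-weight-any : ∀ p l (h : Bool → ℚ) →
    subsetSum l (λ A → weight p A * h (anyFin (lookup A))) ≡ (1ℚ - p) ^ l * h false + blockProb l p * h true
  subsetSum-weight-any p zero    h =
    solve 2 (λ a b → con 1ℚ :* a :+ con 0ℚ := con 1ℚ :* a :+ (con 1ℚ :- con 1ℚ) :* b) refl (h false) (h true)
  subsetSum-weight-any p (suc l) h = begin
    subsetSum (suc l) (λ A → weight p A * h (anyFin (lookup A)))
      ≡⟨ subsetSum-suc l (λ A → weight p A * h (anyFin (lookup A))) ⟩
    subsetSum l (λ A → ((1ℚ - p) * weight p A) * h (anyFin (lookup A))) + subsetSum l (λ A → (p * weight p A) * h true)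
      ≡⟨ cong₂ _+_ (trans (subsetSum-cong l (λ A → *-assoc (1ℚ - p) _ _)) (subsetSum-*ˡ l (1ℚ - p) _))
                   (trans (subsetSum-cong l (λ A → trans (*-assoc p _ _) (cong (p *_) (*-comm (weight p A) (h true)))))
                          (trans (subsetSum-*ˡ l p _) (cong (p *_) (subsetSum-*ˡ l (h true) (weight p))))) ⟩
    (1ℚ - p) * subsetSum l (λ A → weight p A * h (anyFin (lookup A))) + p * (h true * subsetSum l (weight p))
      ≡⟨ cong₂ (λ x y → (1ℚ - p) * x + p * (h true * y)) (subsetSum-weight-any p l h) (subsetSum-weight p l) ⟩
    (1ℚ - p) * ((1ℚ - p) ^ l * h false + blockProb l p * h true) + p * (h true * 1ℚ)
      ≡⟨ solve 4 (λ p x a b → (con 1ℚ :- p) :* (x :* a :+ (con 1ℚ :- x) :* b) :+ p :* (b :* con 1ℚ)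
                            := ((con 1ℚ :- p) :* x) :* a :+ (con 1ℚ :- (con 1ℚ :- p) :* x) :* b)
                 refl p ((1ℚ - p) ^ l) (h false) (h true) ⟩
    (1ℚ - p) ^ suc l * h false + blockProb (suc l) p * h true ∎

  occupiedBlocks-++ : ∀ n l (A : Subset l) (B : Subset (n ℕ.* l)) →
    occupiedBlocks {suc n} l (A Vec.++ B) ≡ anyFin (lookup A) ∷ occupiedBlocks {n} l B
  occupiedBlocks-++ n l A B = cong₂ _∷_
    (anyFin-cong (lookup-++ˡ A B))
    (tabulate-cong λ v → anyFin-cong (λ j → lookup-++ʳ A B (combine v j)))

  -- Grouping the vertices of G[K_l] by blocks: a block is occupied with probability blockProb l p.
  subsetSum-occupiedBlocks : ∀ p l n (F : Subset n → ℚ) →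
    subsetSum (n ℕ.* l) (λ S → F (occupiedBlocks l S) * weight p S) ≡ subsetSum n (λ T → F T * weight (blockProb l p) T)
  subsetSum-occupiedBlocks p l zero    F = refl
  subsetSum-occupiedBlocks p l (suc n) F = begin
    subsetSum (l ℕ.+ n ℕ.* l) (λ S → F (occupiedBlocks l S) * weight p S)
      ≡⟨ subsetSum-++ l (n ℕ.* l) (λ S → F (occupiedBlocks {suc n} l S) * weight p S) ⟩
    subsetSum l (λ A → subsetSum (n ℕ.* l) (λ B → F (occupiedBlocks l (A Vec.++ B)) * weight p (A Vec.++ B)))
      ≡⟨ subsetSum-cong l (λ A → trans (subsetSum-cong (n ℕ.* l) (split A)) (subsetSum-*ˡ (n ℕ.* l) (weight p A) _)) ⟩
    subsetSum l (λ A → weight p A * subsetSum (n ℕ.* l) (λ B → F (anyFin (lookup A) ∷ occupiedBlocks l B) * weight p B))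
      ≡⟨ subsetSum-cong l (λ A → cong (weight p A *_) (subsetSum-occupiedBlocks p l n (F ∘ (anyFin (lookup A) ∷_)))) ⟩
    subsetSum l (λ A → weight p A * H (anyFin (lookup A)))
      ≡⟨ subsetSum-weight-any p l H ⟩
    (1ℚ - p) ^ l * H false + q * H true
      ≡⟨ cong (λ z → z * H false + q * H true) (solve 1 (λ x → x := con 1ℚ :- (con 1ℚ :- x)) refl ((1ℚ - p) ^ l)) ⟩
    (1ℚ - q) * H false + q * H true
      ≡⟨ sym (cong₂ _+_ (subsetSum-*ˡ n (1ℚ - q) _) (subsetSum-*ˡ n q _)) ⟩
    subsetSum n (λ T → (1ℚ - q) * (F (false ∷ T) * weight q T)) + subsetSum n (λ T → q * (F (true ∷ T) * weight q T))
      ≡⟨ cong₂ _+_ (subsetSum-cong n (λ T → swap (1ℚ - q) (F (false ∷ T)) (weight q T)))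
                   (subsetSum-cong n (λ T → swap q (F (true ∷ T)) (weight q T))) ⟩
    subsetSum n (λ T → F (false ∷ T) * weight q (false ∷ T)) + subsetSum n (λ T → F (true ∷ T) * weight q (true ∷ T))
      ≡⟨ sym (subsetSum-suc n (λ T → F T * weight q T)) ⟩
    subsetSum (suc n) (λ T → F T * weight q T) ∎
    where
    q : ℚ
    q = blockProb l p
    H : Bool → ℚ
    H b = subsetSum n (λ T → F (b ∷ T) * weight q T)
    swap : ∀ a x y → a * (x * y) ≡ x * (a * y)
    swap = solve 3 (λ a x y → a :* (x :* y) := x :* (a :* y)) refl
    split : ∀ A B → F (occupiedBlocks l (A Vec.++ B)) * weight p (A Vec.++ B)
                  ≡ weight p A * (F (anyFin (lookup A) ∷ occupiedBlocks l B) * weight p B)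
    split A B rewrite occupiedBlocks-++ n l A B | weight-++ p A B =
      swap (F (anyFin (lookup A) ∷ occupiedBlocks l B)) (weight p A) (weight p B)

  indicator : Bool → ℚ
  indicator b = if b then 1ℚ else 0ℚ

  if-0ℚ : ∀ b x → (if b then x else 0ℚ) ≡ indicator b * x
  if-0ℚ true  x = sym (*-identityˡ x)
  if-0ℚ false x = sym (*-zeroˡ x)

  nodeRel-lexK : ∀ {n} (G : Graph n) l p → nodeRel (lexK G l) p ≡ nodeRel G (blockProb l p)
  nodeRel-lexK {n} G l p = begin
    nodeRel (lexK G l) p
      ≡⟨ subsetSum-cong (n ℕ.* l) (λ S → trans (cong (λ b → if b then weight p S else 0ℚ) (lexK-connected G l S))
                                               (if-0ℚ (connectedInduced G (occupiedBlocks l S)) (weight p S))) ⟩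
    subsetSum (n ℕ.* l) (λ S → indicator (connectedInduced G (occupiedBlocks l S)) * weight p S)
      ≡⟨ subsetSum-occupiedBlocks p l n (indicator ∘ connectedInduced G) ⟩
    subsetSum n (λ T → indicator (connectedInduced G T) * weight (blockProb l p) T)
      ≡⟨ subsetSum-cong n (λ T → sym (if-0ℚ (connectedInduced G T) (weight (blockProb l p) T))) ⟩
    nodeRel G (blockProb l p) ∎

  nodeRel-coneK1 : ∀ {n} (F : Graph n) p → nodeRel (coneK1 F) p ≡ p + (1ℚ - p) * nodeRel F p
  nodeRel-coneK1 {n} F p = begin
    nodeRel (coneK1 F) p
      ≡⟨ subsetSum-suc n (λ S → if connectedInduced (coneK1 F) S then weight p S else 0ℚ) ⟩
    subsetSum n (λ S → if connectedInduced (coneK1 F) (false ∷ S) then (1ℚ - p) * weight p S else 0ℚ)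
      + subsetSum n (λ S → if connectedInduced (coneK1 F) (true ∷ S) then p * weight p S else 0ℚ)
      ≡⟨ cong₂ _+_ (subsetSum-cong n λ S → trans (cong (λ b → if b then (1ℚ - p) * weight p S else 0ℚ)
                                                        (coneK1-connected-without-apex F S))
                                                 (if-*ˡ (connectedInduced F S) (1ℚ - p) (weight p S)))
                   (subsetSum-cong n λ S → if-true (coneK1-apex-connected F S)) ⟩
    subsetSum n (λ S → (1ℚ - p) * (if connectedInduced F S then weight p S else 0ℚ)) + subsetSum n (λ S → p * weight p S)
      ≡⟨ cong₂ _+_ (subsetSum-*ˡ n (1ℚ - p) _) (trans (subsetSum-*ˡ n p (weight p)) (cong (p *_) (subsetSum-weight p n))) ⟩
    (1ℚ - p) * nodeRel F p + p * 1ℚ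
      ≡⟨ solve 2 (λ p x → x :+ p :* con 1ℚ := p :+ x) refl p ((1ℚ - p) * nodeRel F p) ⟩
    p + (1ℚ - p) * nodeRel F p ∎
    where
    if-*ˡ : ∀ b c x → (if b then c * x else 0ℚ) ≡ c * (if b then x else 0ℚ)
    if-*ˡ true  c x = refl
    if-*ˡ false c x = sym (*-zeroʳ c)
    if-true : ∀ {b} {x : ℚ} → T b → (if b then x else 0ℚ) ≡ x
    if-true {true} _ = refl

module RationalFacts where

  open import Data.Nat as ℕ using (ℕ; zero; suc)
  import Data.Nat.Properties as ℕ
  open import Data.Nat.Coprimality as Coprimality using ()
  open import Data.Integer as ℤ using (-[1+_])
  import Data.Integer.Properties as ℤ
  import Data.Integer.Solver as ℤ-Solver
  open import Data.Rational
  open import Data.Rational.Properties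
  import Data.Rational.Unnormalised as ℚᵘ
  import Data.Rational.Unnormalised.Properties as ℚᵘ
  open import Data.Rational.Solver using (module +-*-Solver)
  open import Data.Product using (Σ; ∃; _×_; _,_; proj₁; proj₂)
  open import Data.Sum using (inj₁; inj₂)
  open import Data.Empty using (⊥-elim)
  open import Relation.Nullary using (yes; no)
  open import Relation.Binary.PropositionalEquality using (_≡_; refl; sym; trans; cong; subst; subst₂)
  open +-*-Solver

  Prob : ℚ → Set
  Prob p = 0ℚ ≤ p × p ≤ 1ℚ

  0<1 : 0ℚ < 1ℚ
  0<1 = *<* (ℤ.+<+ (ℕ.s≤s ℕ.z≤n))

  p≤q⇒0≤q-p : ∀ {p q} → p ≤ q → 0ℚ ≤ q - p
  p≤q⇒0≤q-p {p} {q} h = subst (_≤ q - p) (+-inverseʳ p) (+-monoˡ-≤ (- p) h)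

  p<q⇒0<q-p : ∀ {p q} → p < q → 0ℚ < q - p
  p<q⇒0<q-p {p} {q} h = subst (_< q - p) (+-inverseʳ p) (+-monoˡ-< (- p) h)

  -- Most inequalities below are proved by rewriting q - p as a sum of visibly nonnegative terms.
  ≤-by-difference : ∀ {p q} d → q - p ≡ d → 0ℚ ≤ d → p ≤ q
  ≤-by-difference {p} {q} d eq 0≤d = subst₂ _≤_ (+-identityʳ p)
    (trans (cong (p +_) (sym eq)) (solve 2 (λ p q → p :+ (q :- p) := q) refl p q)) (+-monoʳ-≤ p 0≤d)

  <-by-difference : ∀ {p q} d → q - p ≡ d → 0ℚ < d → p < q
  <-by-difference {p} {q} d eq 0<d = subst₂ _<_ (+-identityʳ p)
    (trans (cong (p +_) (sym eq)) (solve 2 (λ p q → p :+ (q :- p) := q) refl p q)) (+-monoʳ-< p 0<d)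

  +-nonNeg : ∀ {p q} → 0ℚ ≤ p → 0ℚ ≤ q → 0ℚ ≤ p + q
  +-nonNeg = +-mono-≤

  +-pos : ∀ {p q} → 0ℚ < p → 0ℚ ≤ q → 0ℚ < p + q
  +-pos = +-mono-<-≤

  *-nonNeg : ∀ {p q} → 0ℚ ≤ p → 0ℚ ≤ q → 0ℚ ≤ p * q
  *-nonNeg {p} {q} 0≤p 0≤q = nonNegative⁻¹ _ {{nonNeg*nonNeg⇒nonNeg p {{nonNegative 0≤p}} q {{nonNegative 0≤q}}}}

  *-pos : ∀ {p q} → 0ℚ < p → 0ℚ < q → 0ℚ < p * q
  *-pos {p} {q} 0<p 0<q = positive⁻¹ _ {{pos*pos⇒pos p {{positive 0<p}} q {{positive 0<q}}}}

  p≤∣p∣ : ∀ p → p ≤ ∣ p ∣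
  p≤∣p∣ p with ≤-total 0ℚ p
  ... | inj₁ 0≤p = ≤-reflexive (sym (0≤p⇒∣p∣≡p 0≤p))
  ... | inj₂ p≤0 = ≤-trans p≤0 (0≤∣p∣ p)

  ∣p-q∣≡∣q-p∣ : ∀ p q → ∣ p - q ∣ ≡ ∣ q - p ∣
  ∣p-q∣≡∣q-p∣ p q =
    trans (sym (∣-p∣≡∣p∣ (p - q))) (cong ∣_∣ (solve 2 (λ p q → :- (p :- q) := q :- p) refl p q))

  separated : ∀ {x y a b ε} → ∣ x - a ∣ ≤ ε → ∣ y - b ∣ ≤ ε → ε + ε < a - b → y < x
  separated {x} {y} {a} {b} {ε} x≈a y≈b gap = <-by-difference _
    (solve 5 (λ x y a b ε → x :- y := ((a :- b) :- (ε :+ ε)) :+ ((ε :- (a :- x)) :+ (ε :- (y :- b)))) refl x y a b ε)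
    (+-pos (p<q⇒0<q-p gap) (+-nonNeg (p≤q⇒0≤q-p a-x≤ε) (p≤q⇒0≤q-p y-b≤ε)))
    where
    a-x≤ε : a - x ≤ ε
    a-x≤ε = ≤-trans (p≤∣p∣ (a - x)) (subst (_≤ ε) (∣p-q∣≡∣q-p∣ x a) x≈a)
    y-b≤ε : y - b ≤ ε
    y-b≤ε = ≤-trans (p≤∣p∣ (y - b)) y≈b

  ι : ℕ → ℚ
  ι zero    = 0ℚ
  ι (suc n) = 1ℚ + ι n

  ι-nonNeg : ∀ n → 0ℚ ≤ ι n
  ι-nonNeg zero    = ≤-refl
  ι-nonNeg (suc n) = +-nonNeg (<⇒≤ 0<1) (ι-nonNeg n)

  ι-pos : ∀ n → 0ℚ < ι (suc n)
  ι-pos n = +-pos 0<1 (ι-nonNeg n)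

  ι-mono-≤ : ∀ {m n} → m ℕ.≤ n → ι m ≤ ι n
  ι-mono-≤ {zero}  {n}     _            = ι-nonNeg n
  ι-mono-≤ {suc m} {suc n} (ℕ.s≤s m≤n) = +-monoʳ-≤ 1ℚ (ι-mono-≤ m≤n)

  _/1 : ℕ → ℚ
  m /1 = mkℚ (ℤ.+ m) 0 (Coprimality.sym (Coprimality.1-coprimeTo m))

  ι≡/1 : ∀ m → ι m ≡ m /1
  ι≡/1 zero    = refl
  ι≡/1 (suc m) rewrite ι≡/1 m = toℚᵘ-injective (ℚᵘ.≃-trans (toℚᵘ-homo-+ 1ℚ (m /1)) (ℚᵘ.*≡*
    (ℤ-solve 1 (λ x → (ℤ-con (ℤ.+ 1) ⊛ ℤ-con (ℤ.+ 1) ⊕ x ⊛ ℤ-con (ℤ.+ 1)) ⊛ ℤ-con (ℤ.+ 1)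
                     ≐ (ℤ-con (ℤ.+ 1) ⊕ x) ⊛ (ℤ-con (ℤ.+ 1) ⊛ ℤ-con (ℤ.+ 1))) refl (ℤ.+ m))))
    where
    open ℤ-Solver.+-*-Solver using () renaming (solve to ℤ-solve; _:+_ to _⊕_; _:*_ to _⊛_; _:=_ to _≐_; con to ℤ-con)

  -- A nonnegative rational m / (d + 1) is at most m.
  ι-unbounded : ∀ p → ∃ λ M → p ≤ ι M
  ι-unbounded p@(mkℚ (ℤ.+ m) d _) = m , subst (p ≤_) (sym (ι≡/1 m))
    (*≤* (subst₂ ℤ._≤_ (ℤ.pos-* m 1) (ℤ.pos-* m (suc d)) (ℤ.+≤+ (ℕ.*-monoʳ-≤ m (ℕ.s≤s ℕ.z≤n)))))
  ι-unbounded (mkℚ -[1+ m ] d _) = 0 , *≤* ℤ.-≤+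

  archimedean : ∀ p {ε} → 0ℚ < ε → ∃ λ M → p ≤ ι M * ε
  archimedean p {ε} 0<ε = M , subst (_≤ ι M * ε) p/ε*ε≡p (*-monoʳ-≤-nonNeg ε {{nonNegative (<⇒≤ 0<ε)}} p/ε≤M)
    where
    instance
      ε≢0 : NonZero ε
      ε≢0 = pos⇒nonZero ε {{positive 0<ε}}
    M : ℕ
    M = proj₁ (ι-unbounded (p * 1/ ε))
    p/ε≤M : p * 1/ ε ≤ ι M
    p/ε≤M = proj₂ (ι-unbounded (p * 1/ ε))
    p/ε*ε≡p : p * 1/ ε * ε ≡ p
    p/ε*ε≡p = trans (*-assoc p (1/ ε) ε) (trans (cong (p *_) (*-inverseˡ ε)) (*-identityʳ p))

  ∃-small-multiple : ∀ {K η} → 0ℚ ≤ K → 0ℚ < η → ∃ λ E → 0ℚ < E × K * E ≤ η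
  ∃-small-multiple {K} {η} 0≤K 0<η = η * 1/ (1ℚ + K) , *-pos 0<η (positive⁻¹ _ {{1/pos⇒pos (1ℚ + K)}}) , KE≤η
    where
    instance
      1+K>0 : Positive (1ℚ + K)
      1+K>0 = positive (+-pos 0<1 0≤K)
      1+K≢0 : NonZero (1ℚ + K)
      1+K≢0 = pos⇒nonZero (1ℚ + K)
    E : ℚ
    E = η * 1/ (1ℚ + K)
    KE≤η : K * E ≤ η
    KE≤η = ≤-by-difference E
      (trans (cong (_- K * E) (sym (trans (*-assoc η _ _) (trans (cong (η *_) (*-inverseˡ (1ℚ + K))) (*-identityʳ η)))))
             (solve 3 (λ η r K → η :* r :* (con 1ℚ :+ K) :- K :* (η :* r) := η :* r) refl η (1/ (1ℚ + K)) K))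
      (*-nonNeg (<⇒≤ 0<η) (<⇒≤ (positive⁻¹ _ {{1/pos⇒pos (1ℚ + K)}})))

  ⊓-pos : ∀ {p q} → 0ℚ < p → 0ℚ < q → 0ℚ < p ⊓ q
  ⊓-pos {p} {q} 0<p 0<q with ⊓-sel p q
  ... | inj₁ eq = subst (0ℚ <_) (sym eq) 0<p
  ... | inj₂ eq = subst (0ℚ <_) (sym eq) 0<q

  ∃-fourfold-below : ∀ {δ} → 0ℚ < δ → δ ≤ 1ℚ → ∃ λ η → 0ℚ < η × η < 1ℚ × (η + η) + (η + η) < δ
  ∃-fourfold-below {δ} 0<δ δ≤1 = η , 0<η , η<1 , 4η<δ
    where
    η : ℚ
    η = ½ * (½ * (½ * δ))
    0<η : 0ℚ < η
    0<η = *-pos (positive⁻¹ ½) (*-pos (positive⁻¹ ½) (*-pos (positive⁻¹ ½) 0<δ))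
    4η<δ : (η + η) + (η + η) < δ
    4η<δ = <-by-difference ((η + η) + (η + η))
      (solve 1 (λ δ → let η = con ½ :* (con ½ :* (con ½ :* δ))
                      in δ :- ((η :+ η) :+ (η :+ η)) := (η :+ η) :+ (η :+ η)) refl δ)
      (+-pos (+-pos 0<η (<⇒≤ 0<η)) (<⇒≤ (+-pos 0<η (<⇒≤ 0<η))))
    η<1 : η < 1ℚ
    η<1 = <-≤-trans (<-trans η<4η 4η<δ) δ≤1
      where
      η<4η : η < (η + η) + (η + η)
      η<4η = <-by-difference ((η + η) + η) (solve 1 (λ η → ((η :+ η) :+ (η :+ η)) :- η := (η :+ η) :+ η) refl η)
                             (+-pos (+-pos 0<η (<⇒≤ 0<η)) (<⇒≤ 0<η))

  crossing : ∀ (f : ℕ → ℚ) y m → f 0 ≤ y → y < f m → ∃ λ j → j ℕ.< m × f j ≤ y × y < f (suc j)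
  crossing f y zero    f₀≤y y<f₀ = ⊥-elim (<-irrefl refl (≤-<-trans f₀≤y y<f₀))
  crossing f y (suc m) f₀≤y y<fₘ₊₁ with y <? f m
  ... | yes y<fₘ = let (j , j<m , fⱼ≤y , y<fⱼ₊₁) = crossing f y m f₀≤y y<fₘ
                   in j , ℕ.m<n⇒m<1+n j<m , fⱼ≤y , y<fⱼ₊₁
  ... | no  y≮fₘ = m , ℕ.≤-refl , ≮⇒≥ y≮fₘ , y<fₘ₊₁

  bounded-choice : ∀ {A : Set} {P : ℕ → A → Set} → A → ∀ m →
                   (∀ i → i ℕ.< m → Σ A (P i)) → Σ (ℕ → A) λ f → ∀ i → i ℕ.< m → P i (f i)
  bounded-choice {A} {P} default m choose = f , f-spec
    where
    f : ℕ → A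
    f i with i ℕ.<? m
    ... | yes i<m = proj₁ (choose i i<m)
    ... | no  _   = default
    f-spec : ∀ i → i ℕ.< m → P i (f i)
    f-spec i i<m with i ℕ.<? m
    ... | yes i<m′ = proj₂ (choose i i<m′)
    ... | no  i≮m  = ⊥-elim (i≮m i<m)

  positiveLowerBound : ∀ m (f : ℕ → ℚ) → (∀ i → i ℕ.< m → 0ℚ < f i) →
                       ∃ λ μ → 0ℚ < μ × μ ≤ 1ℚ × ∀ i → i ℕ.< m → μ ≤ f i
  positiveLowerBound zero    f pos = 1ℚ , 0<1 , ≤-refl , λ i ()
  positiveLowerBound (suc m) f pos with positiveLowerBound m f (λ i i<m → pos i (ℕ.m<n⇒m<1+n i<m))
  ... | μ , 0<μ , μ≤1 , μ≤f = μ ⊓ f m , ⊓-pos 0<μ (pos m ℕ.≤-refl) , p≤q⇒p⊓r≤q (f m) μ≤1 , bound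
    where
    bound : ∀ i → i ℕ.< suc m → μ ⊓ f m ≤ f i
    bound i i<1+m with ℕ.m<1+n⇒m<n∨m≡n i<1+m
    ... | inj₁ i<m  = p≤q⇒p⊓r≤q (f m) (μ≤f i i<m)
    ... | inj₂ refl = p⊓q≤q μ (f m)

module ReliabilityBounds where

  open import Defs hiding (sym)
  open ReliabilityFormulas
  open RationalFacts
  open import Data.Bool using (Bool; true; false; if_then_else_)
  open import Data.Nat using (zero; suc)
  open import Data.List using (List; []; _∷_)
  open import Data.Vec using ([]; _∷_)
  open import Data.Rational
  open import Data.Rational.Properties
  open import Data.Rational.Solver using (module +-*-Solver)
  open import Data.Product using (∃; _×_; _,_; proj₁)
  open import Relation.Binary.PropositionalEquality using (_≡_; refl; sym; trans; cong; subst; subst₂)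
  open +-*-Solver

  Prob-complement : ∀ {p} → Prob p → Prob (1ℚ - p)
  Prob-complement {p} (0≤p , p≤1) =
    ≤-by-difference _ (solve 1 (λ p → (con 1ℚ :- p) :- con 0ℚ := con 1ℚ :- p) refl p) (p≤q⇒0≤q-p p≤1) ,
    ≤-by-difference p (solve 1 (λ p → con 1ℚ :- (con 1ℚ :- p) := p) refl p) 0≤p

  Prob-* : ∀ {p q} → Prob p → Prob q → Prob (p * q)
  Prob-* {p} {q} (0≤p , p≤1) (0≤q , q≤1) =
    *-nonNeg 0≤p 0≤q ,
    ≤-trans (*-monoʳ-≤-nonNeg q {{nonNegative 0≤q}} p≤1) (subst (_≤ 1ℚ) (sym (*-identityˡ q)) q≤1)

  Prob-^ : ∀ {p} l → Prob p → Prob (p ^ l)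
  Prob-^ zero    _  = <⇒≤ 0<1 , ≤-refl
  Prob-^ (suc l) pr = Prob-* pr (Prob-^ l pr)

  weight-Prob : ∀ {n p} (S : Subset n) → Prob p → Prob (weight p S)
  weight-Prob []          pr = <⇒≤ 0<1 , ≤-refl
  weight-Prob (true  ∷ S) pr = Prob-* pr (weight-Prob S pr)
  weight-Prob (false ∷ S) pr = Prob-* (Prob-complement pr) (weight-Prob S pr)

  ∣p*q∣≤∣q∣ : ∀ {p} q → Prob p → ∣ p * q ∣ ≤ ∣ q ∣
  ∣p*q∣≤∣q∣ {p} q (0≤p , p≤1) = subst₂ _≤_ (sym (∣p*q∣≡∣p∣*∣q∣ p q)) (*-identityˡ ∣ q ∣)
    (*-monoʳ-≤-nonNeg ∣ q ∣ {{nonNegative (0≤∣p∣ q)}} (subst (_≤ 1ℚ) (sym (0≤p⇒∣p∣≡p 0≤p)) p≤1))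

  module _ {A : Set} where

    sumOver-mono-≤ : ∀ (xs : List A) {f g} → (∀ x → f x ≤ g x) → sumOver xs f ≤ sumOver xs g
    sumOver-mono-≤ []       f≤g = ≤-refl
    sumOver-mono-≤ (x ∷ xs) f≤g = +-mono-≤ (f≤g x) (sumOver-mono-≤ xs f≤g)

    sumOver-nonNeg : ∀ (xs : List A) {f} → (∀ x → 0ℚ ≤ f x) → 0ℚ ≤ sumOver xs f
    sumOver-nonNeg []       _   = ≤-refl
    sumOver-nonNeg (x ∷ xs) 0≤f = +-nonNeg (0≤f x) (sumOver-nonNeg xs 0≤f)

    ∣sumOver-sumOver∣≤ : ∀ (xs : List A) f g →
                         ∣ sumOver xs f - sumOver xs g ∣ ≤ sumOver xs (λ x → ∣ f x - g x ∣)
    ∣sumOver-sumOver∣≤ []       f g = ≤-refl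
    ∣sumOver-sumOver∣≤ (x ∷ xs) f g = ≤-trans
      (≤-reflexive (cong ∣_∣ (solve 4 (λ a b c d → (a :+ b) :- (c :+ d) := (a :- c) :+ (b :- d)) refl
                                      (f x) (sumOver xs f) (g x) (sumOver xs g))))
      (≤-trans (∣p+q∣≤∣p∣+∣q∣ (f x - g x) (sumOver xs f - sumOver xs g))
               (+-monoʳ-≤ ∣ f x - g x ∣ (∣sumOver-sumOver∣≤ xs f g)))

  nodeRel-Prob : ∀ {n} (G : Graph n) {p} → Prob p → Prob (nodeRel G p)
  nodeRel-Prob {n} G {p} pr =
    sumOver-nonNeg (allSubsets n) (λ S → if-nonNeg (connectedInduced G S) (proj₁ (weight-Prob S pr))) ,
    subst (nodeRel G p ≤_) (subsetSum-weight p n)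
      (sumOver-mono-≤ (allSubsets n) λ S → if-≤ (connectedInduced G S) (proj₁ (weight-Prob S pr)))
    where
    if-nonNeg : ∀ b {w} → 0ℚ ≤ w → 0ℚ ≤ (if b then w else 0ℚ)
    if-nonNeg true  0≤w = 0≤w
    if-nonNeg false _   = ≤-refl
    if-≤ : ∀ b {w} → 0ℚ ≤ w → (if b then w else 0ℚ) ≤ w
    if-≤ true  _   = ≤-refl
    if-≤ false 0≤w = 0≤w

  weight-lipschitz : ∀ {n x y} (S : Subset n) → Prob x → Prob y → ∣ weight x S - weight y S ∣ ≤ ι n * ∣ x - y ∣
  weight-lipschitz {x = x} {y} [] _ _ =
    ≤-reflexive (trans (cong ∣_∣ (+-inverseʳ 1ℚ)) (sym (*-zeroˡ ∣ x - y ∣)))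
  weight-lipschitz {suc n} {x} {y} (b ∷ S) prx pry = begin
    ∣ weight x (b ∷ S) - weight y (b ∷ S) ∣
      ≡⟨ cong ∣_∣ (split b) ⟩
    ∣ factor b x * (Wx - Wy) + Wy * (factor b x - factor b y) ∣
      ≤⟨ ∣p+q∣≤∣p∣+∣q∣ (factor b x * (Wx - Wy)) (Wy * (factor b x - factor b y)) ⟩
    ∣ factor b x * (Wx - Wy) ∣ + ∣ Wy * (factor b x - factor b y) ∣
      ≤⟨ +-mono-≤ (∣p*q∣≤∣q∣ (Wx - Wy) (factor-Prob b prx))
                  (∣p*q∣≤∣q∣ (factor b x - factor b y) (weight-Prob S pry)) ⟩
    ∣ Wx - Wy ∣ + ∣ factor b x - factor b y ∣
      ≤⟨ +-mono-≤ (weight-lipschitz S prx pry) (≤-reflexive (factor-distance b)) ⟩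
    ι n * ∣ x - y ∣ + ∣ x - y ∣
      ≡⟨ solve 2 (λ i d → i :* d :+ d := (con 1ℚ :+ i) :* d) refl (ι n) ∣ x - y ∣ ⟩
    ι (suc n) * ∣ x - y ∣ ∎
    where
    open ≤-Reasoning
    Wx Wy : ℚ
    Wx = weight x S
    Wy = weight y S
    factor : Bool → ℚ → ℚ
    factor true  p = p
    factor false p = 1ℚ - p
    factor-Prob : ∀ b {p} → Prob p → Prob (factor b p)
    factor-Prob true  pr = pr
    factor-Prob false pr = Prob-complement pr
    factor-distance : ∀ b → ∣ factor b x - factor b y ∣ ≡ ∣ x - y ∣
    factor-distance true  = refl
    factor-distance false = trans (cong ∣_∣ (solve 2 (λ x y → (con 1ℚ :- x) :- (con 1ℚ :- y) := y :- x) refl x y))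
                                  (∣p-q∣≡∣q-p∣ y x)
    split : ∀ b → weight x (b ∷ S) - weight y (b ∷ S) ≡ factor b x * (Wx - Wy) + Wy * (factor b x - factor b y)
    split true  = solve 4 (λ a c u v → a :* u :- c :* v := a :* (u :- v) :+ v :* (a :- c)) refl x y Wx Wy
    split false = solve 4 (λ a c u v → (con 1ℚ :- a) :* u :- (con 1ℚ :- c) :* v
                                    := (con 1ℚ :- a) :* (u :- v) :+ v :* ((con 1ℚ :- a) :- (con 1ℚ :- c))) refl x y Wx Wy

  nodeRel-lipschitz : ∀ {n} (G : Graph n) →
    ∃ λ K → 0ℚ ≤ K × ∀ {x y} → Prob x → Prob y → ∣ nodeRel G x - nodeRel G y ∣ ≤ K * ∣ x - y ∣
  nodeRel-lipschitz {n} G = K , sumOver-nonNeg (allSubsets n) (λ _ → ι-nonNeg n) , lipschitz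
    where
    K : ℚ
    K = subsetSum n (λ _ → ι n)
    lipschitz : ∀ {x y} → Prob x → Prob y → ∣ nodeRel G x - nodeRel G y ∣ ≤ K * ∣ x - y ∣
    lipschitz {x} {y} prx pry = begin
      ∣ nodeRel G x - nodeRel G y ∣
        ≤⟨ ∣sumOver-sumOver∣≤ (allSubsets n) (term x) (term y) ⟩
      subsetSum n (λ S → ∣ term x S - term y S ∣)
        ≤⟨ sumOver-mono-≤ (allSubsets n) term-lipschitz ⟩
      subsetSum n (λ _ → ∣ x - y ∣ * ι n)
        ≡⟨ subsetSum-*ˡ n ∣ x - y ∣ (λ _ → ι n) ⟩
      ∣ x - y ∣ * K
        ≡⟨ *-comm ∣ x - y ∣ K ⟩
      K * ∣ x - y ∣ ∎
      where
      open ≤-Reasoning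
      term : ℚ → Subset n → ℚ
      term p S = if connectedInduced G S then weight p S else 0ℚ
      term-lipschitz : ∀ S → ∣ term x S - term y S ∣ ≤ ∣ x - y ∣ * ι n
      term-lipschitz S with connectedInduced G S
      ... | true  = subst (∣ weight x S - weight y S ∣ ≤_) (*-comm (ι n) ∣ x - y ∣) (weight-lipschitz S prx pry)
      ... | false = *-nonNeg (0≤∣p∣ (x - y)) (ι-nonNeg n)

  coneK1-apex-bound : ∀ {n} (F : Graph n) {p} → Prob p → p ≤ nodeRel (coneK1 F) p
  coneK1-apex-bound F {p} pr = subst (p ≤_) (sym (nodeRel-coneK1 F p))
    (≤-by-difference _ (solve 2 (λ p x → (p :+ x) :- p := x) refl p ((1ℚ - p) * nodeRel F p))
      (*-nonNeg (proj₁ (Prob-complement pr)) (proj₁ (nodeRel-Prob F pr))))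

  coneK1-perturbation : ∀ {n} (F : Graph n) {p} b → Prob p → ∣ nodeRel (coneK1 F) p - b ∣ ≤ p + ∣ nodeRel F p - b ∣
  coneK1-perturbation F {p} b pr = begin
    ∣ nodeRel (coneK1 F) p - b ∣
      ≡⟨ cong (λ z → ∣ z - b ∣) (nodeRel-coneK1 F p) ⟩
    ∣ (p + (1ℚ - p) * N) - b ∣
      ≡⟨ cong ∣_∣ (solve 3 (λ p N b → (p :+ (con 1ℚ :- p) :* N) :- b := (con 1ℚ :- N) :* p :+ (N :- b)) refl p N b) ⟩
    ∣ (1ℚ - N) * p + (N - b) ∣
      ≤⟨ ∣p+q∣≤∣p∣+∣q∣ ((1ℚ - N) * p) (N - b) ⟩
    ∣ (1ℚ - N) * p ∣ + ∣ N - b ∣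
      ≤⟨ +-monoˡ-≤ ∣ N - b ∣ (≤-trans (∣p*q∣≤∣q∣ p (Prob-complement (nodeRel-Prob F pr)))
                                       (≤-reflexive (0≤p⇒∣p∣≡p (proj₁ pr)))) ⟩
    p + ∣ N - b ∣ ∎
    where
    open ≤-Reasoning
    N : ℚ
    N = nodeRel F p

module BlockProbability where

  open import Defs using (_^_)
  open ReliabilityFormulas using (blockProb)
  open RationalFacts
  open ReliabilityBounds
  open import Data.Nat as ℕ using (ℕ; zero; suc)
  import Data.Nat.Properties as ℕ
  open import Data.Rational
  open import Data.Rational.Properties
  open import Data.Rational.Solver using (module +-*-Solver)
  open import Data.Product using (∃; _×_; _,_; proj₁; proj₂)
  open import Data.Empty using (⊥-elim)
  open import Relation.Nullary using (yes; no)
  open import Relation.Binary.PropositionalEquality using (_≡_; refl; sym; trans; cong; subst; subst₂)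
  open +-*-Solver

  ^-difference : ∀ {a b} l → 0ℚ ≤ b → b ≤ a → a ≤ 1ℚ → 0ℚ ≤ a ^ l - b ^ l × a ^ l - b ^ l ≤ ι l * (a - b)
  ^-difference {a} {b} zero 0≤b b≤a a≤1 =
    ≤-reflexive (sym (+-inverseʳ 1ℚ)) , ≤-reflexive (trans (+-inverseʳ 1ℚ) (sym (*-zeroˡ (a - b))))
  ^-difference {a} {b} (suc l) 0≤b b≤a a≤1 =
    ≤-by-difference (a * D + (a - b) * B)
      (solve 4 (λ a b A B → (a :* A :- b :* B) :- con 0ℚ := a :* (A :- B) :+ (a :- b) :* B) refl a b (a ^ l) B)
      (+-nonNeg (*-nonNeg 0≤a 0≤D) (*-nonNeg 0≤a-b (proj₁ B∈[0,1]))) ,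
    ≤-by-difference ((ι l * (a - b) - D) + (1ℚ - a) * D + (a - b) * (1ℚ - B))
      (solve 5 (λ a b A B i → (con 1ℚ :+ i) :* (a :- b) :- (a :* A :- b :* B)
                            := ((i :* (a :- b) :- (A :- B)) :+ (con 1ℚ :- a) :* (A :- B)) :+ (a :- b) :* (con 1ℚ :- B))
             refl a b (a ^ l) B (ι l))
      (+-nonNeg (+-nonNeg (p≤q⇒0≤q-p D≤) (*-nonNeg (p≤q⇒0≤q-p a≤1) 0≤D))
                (*-nonNeg 0≤a-b (p≤q⇒0≤q-p (proj₂ B∈[0,1]))))
    where
    B D : ℚ
    B = b ^ l
    D = a ^ l - B
    0≤a : 0ℚ ≤ a
    0≤a = ≤-trans 0≤b b≤a
    0≤a-b : 0ℚ ≤ a - b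
    0≤a-b = p≤q⇒0≤q-p b≤a
    0≤D : 0ℚ ≤ D
    0≤D = proj₁ (^-difference l 0≤b b≤a a≤1)
    D≤ : D ≤ ι l * (a - b)
    D≤ = proj₂ (^-difference l 0≤b b≤a a≤1)
    B∈[0,1] : Prob B
    B∈[0,1] = Prob-^ l (0≤b , ≤-trans b≤a a≤1)

  bernoulli : ∀ {p} l → Prob p → (1ℚ - p) ^ l * (1ℚ + ι l * p) ≤ 1ℚ
  bernoulli {p} zero _ = ≤-reflexive (solve 1 (λ p → con 1ℚ :* (con 1ℚ :+ con 0ℚ :* p) := con 1ℚ) refl p)
  bernoulli {p} (suc l) pr =
    ≤-by-difference ((1ℚ - u * (1ℚ + ι l * p)) + u * (p * p) * (1ℚ + ι l))
      (solve 3 (λ p u i → con 1ℚ :- ((con 1ℚ :- p) :* u) :* (con 1ℚ :+ (con 1ℚ :+ i) :* p)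
                        := (con 1ℚ :- u :* (con 1ℚ :+ i :* p)) :+ u :* (p :* p) :* (con 1ℚ :+ i)) refl p u (ι l))
      (+-nonNeg (p≤q⇒0≤q-p (bernoulli l pr))
                (*-nonNeg (*-nonNeg (proj₁ (Prob-^ l (Prob-complement pr))) (*-nonNeg (proj₁ pr) (proj₁ pr)))
                          (ι-nonNeg (suc l))))
    where
    u : ℚ
    u = (1ℚ - p) ^ l

  blockProb-difference : ∀ l {x y} → Prob x → Prob y → x ≤ y →
                         0ℚ ≤ blockProb l y - blockProb l x × blockProb l y - blockProb l x ≤ ι l * (y - x)
  blockProb-difference l {x} {y} prx pry x≤y =
    subst (0ℚ ≤_) rearrange (proj₁ bounds) , subst₂ _≤_ rearrange (cong (ι l *_) flip) (proj₂ bounds)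
    where
    flip : (1ℚ - x) - (1ℚ - y) ≡ y - x
    flip = solve 2 (λ x y → (con 1ℚ :- x) :- (con 1ℚ :- y) := y :- x) refl x y
    bounds : 0ℚ ≤ (1ℚ - x) ^ l - (1ℚ - y) ^ l × (1ℚ - x) ^ l - (1ℚ - y) ^ l ≤ ι l * ((1ℚ - x) - (1ℚ - y))
    bounds = ^-difference l (proj₁ (Prob-complement pry)) (≤-by-difference (y - x) flip (p≤q⇒0≤q-p x≤y))
                            (proj₂ (Prob-complement prx))
    rearrange : (1ℚ - x) ^ l - (1ℚ - y) ^ l ≡ blockProb l y - blockProb l x
    rearrange = solve 2 (λ A B → A :- B := (con 1ℚ :- B) :- (con 1ℚ :- A)) refl ((1ℚ - x) ^ l) ((1ℚ - y) ^ l)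

  blockProb-zero : ∀ l → blockProb l 0ℚ ≡ 0ℚ
  blockProb-zero l = trans (cong (λ z → 1ℚ - z) (1^ l)) (+-inverseʳ 1ℚ)
    where
    1^ : ∀ l → (1ℚ - 0ℚ) ^ l ≡ 1ℚ
    1^ zero    = refl
    1^ (suc l) = cong (1ℚ *_) (1^ l)

  -- By Bernoulli's inequality (1 - η) ^ l ≤ 1 / (1 + l η).
  ^-eventually-< : ∀ {η γ} → 0ℚ < η → η ≤ 1ℚ → 0ℚ < γ → ∃ λ m → (1ℚ - η) ^ suc m < γ
  ^-eventually-< {η} {γ} 0<η η≤1 0<γ = m , *-cancelʳ-<-nonNeg c {{nonNegative (<⇒≤ 0<c)}} uc<γc
    where
    m : ℕ
    m = proj₁ (archimedean 1ℚ (*-pos 0<η 0<γ))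
    L u c : ℚ
    L = ι (suc m)
    u = (1ℚ - η) ^ suc m
    c = 1ℚ + L * η
    0<c : 0ℚ < c
    0<c = +-pos 0<1 (*-nonNeg (ι-nonNeg (suc m)) (<⇒≤ 0<η))
    1≤Lηγ : 1ℚ ≤ L * (η * γ)
    1≤Lηγ = ≤-trans (proj₂ (archimedean 1ℚ (*-pos 0<η 0<γ)))
                    (*-monoʳ-≤-nonNeg (η * γ) {{nonNegative (*-nonNeg (<⇒≤ 0<η) (<⇒≤ 0<γ))}}
                                      (ι-mono-≤ (ℕ.n≤1+n m)))
    uc<γc : u * c < γ * c
    uc<γc = <-by-difference (γ + ((L * (η * γ) - 1ℚ) + (1ℚ - u * c)))
      (solve 5 (λ γ u L η c → γ :* (con 1ℚ :+ L :* η) :- u :* (con 1ℚ :+ L :* η)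
                           := γ :+ ((L :* (η :* γ) :- con 1ℚ) :+ (con 1ℚ :- u :* (con 1ℚ :+ L :* η)))) refl γ u L η c)
      (+-pos 0<γ (+-nonNeg (p≤q⇒0≤q-p 1≤Lηγ) (p≤q⇒0≤q-p (bernoulli (suc m) (<⇒≤ 0<η , η≤1)))))

  record Overshoot (l : ℕ) (η E α p : ℚ) : Set where
    field
      0<p   : 0ℚ < p
      p≤η   : p ≤ η
      α<q   : α < blockProb l p
      q≤α+E : blockProb l p ≤ α + E

  -- blockProb l is increasing and l-Lipschitz, so a fine enough grid on [0, η] has a point where it just passes α.
  blockProb-overshoot : ∀ l {η α E} → 0ℚ < η → η ≤ 1ℚ → 0ℚ ≤ α → α < blockProb l η → 0ℚ < E →
                        ∃ λ p → Overshoot l η E α p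
  blockProb-overshoot l {η} {α} {E} 0<η η≤1 0≤α α<qη 0<E =
    let (j , j<M , qⱼ≤α , α<qⱼ₊₁) = crossing (λ i → blockProb l (x i)) α M q₀≤α α<qₘ
    in x (suc j) , record { 0<p = *-pos (ι-pos j) 0<h ; p≤η = x≤η (suc j) j<M ; α<q = α<qⱼ₊₁
                          ; q≤α+E = ≤-trans (grid-step j j<M) (+-monoˡ-≤ E qⱼ≤α) }
    where
    M₀ : ℕ
    M₀ = proj₁ (archimedean (ι l * η) 0<E)
    M : ℕ
    M = suc M₀
    instance
      ιM≢0 : NonZero (ι M)
      ιM≢0 = pos⇒nonZero (ι M) {{positive (ι-pos M₀)}}
    0<1/ιM : 0ℚ < 1/ ι M
    0<1/ιM = positive⁻¹ _ {{1/pos⇒pos (ι M) {{positive (ι-pos M₀)}}}}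
    h : ℚ
    h = η * 1/ (ι M)
    0<h : 0ℚ < h
    0<h = *-pos 0<η 0<1/ιM
    x : ℕ → ℚ
    x i = ι i * h
    ιM*h≡η : ι M * h ≡ η
    ιM*h≡η = trans (solve 3 (λ a b c → a :* (b :* c) := b :* (a :* c)) refl (ι M) η (1/ (ι M)))
                   (trans (cong (η *_) (*-inverseʳ (ι M))) (*-identityʳ η))
    x≤η : ∀ i → i ℕ.≤ M → x i ≤ η
    x≤η i i≤M = subst (x i ≤_) ιM*h≡η (*-monoʳ-≤-nonNeg h {{nonNegative (<⇒≤ 0<h)}} (ι-mono-≤ i≤M))
    x-Prob : ∀ i → i ℕ.≤ M → Prob (x i)
    x-Prob i i≤M = *-nonNeg (ι-nonNeg i) (<⇒≤ 0<h) , ≤-trans (x≤η i i≤M) η≤1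
    q₀≤α : blockProb l (x 0) ≤ α
    q₀≤α = subst (_≤ α) (sym (trans (cong (blockProb l) (*-zeroˡ h)) (blockProb-zero l))) 0≤α
    α<qₘ : α < blockProb l (x M)
    α<qₘ = subst (λ z → α < blockProb l z) (sym ιM*h≡η) α<qη
    lh≤E : ι l * h ≤ E
    lh≤E = begin
      ι l * h                  ≡⟨ sym (*-assoc (ι l) η (1/ ι M)) ⟩
      ι l * η * 1/ ι M         ≤⟨ *-monoʳ-≤-nonNeg (1/ ι M) {{nonNegative (<⇒≤ 0<1/ιM)}}
                                    (≤-trans (proj₂ (archimedean (ι l * η) 0<E))
                                             (*-monoʳ-≤-nonNeg E {{nonNegative (<⇒≤ 0<E)}} (ι-mono-≤ (ℕ.n≤1+n M₀)))) ⟩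
      ι M * E * 1/ ι M         ≡⟨ solve 3 (λ m e r → m :* e :* r := e :* (m :* r)) refl (ι M) E (1/ ι M) ⟩
      E * (ι M * 1/ ι M)       ≡⟨ trans (cong (E *_) (*-inverseʳ (ι M))) (*-identityʳ E) ⟩
      E ∎
      where open ≤-Reasoning
    grid-step : ∀ j → j ℕ.< M → blockProb l (x (suc j)) ≤ blockProb l (x j) + E
    grid-step j j<M = ≤-by-difference ((E - ι l * h) + (ι l * h - (blockProb l (x (suc j)) - blockProb l (x j))))
      (solve 4 (λ e d q₊ q → (q :+ e) :- q₊ := (e :- d) :+ (d :- (q₊ :- q))) refl
             E (ι l * h) (blockProb l (x (suc j))) (blockProb l (x j)))
      (+-nonNeg (p≤q⇒0≤q-p lh≤E) (p≤q⇒0≤q-p (subst (λ d → blockProb l (x (suc j)) - blockProb l (x j) ≤ ι l * d) x₊-x≡h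
        (proj₂ (blockProb-difference l (x-Prob j (ℕ.<⇒≤ j<M)) (x-Prob (suc j) j<M)
                                       (*-monoʳ-≤-nonNeg h {{nonNegative (<⇒≤ 0<h)}} (ι-mono-≤ (ℕ.n≤1+n j))))))))
      where
      x₊-x≡h : x (suc j) - x j ≡ h
      x₊-x≡h = solve 2 (λ i h → (con 1ℚ :+ i) :* h :- i :* h := h) refl (ι j) h

  blockProb-cancel-< : ∀ l {x y} → Prob x → Prob y → blockProb l x < blockProb l y → x < y
  blockProb-cancel-< l {x} {y} prx pry qx<qy with y ≤? x
  ... | no  y≰x = ≰⇒> y≰x
  ... | yes y≤x = ⊥-elim (<-irrefl refl (<-≤-trans qx<qy qy≤qx))
    where
    qy≤qx : blockProb l y ≤ blockProb l x
    qy≤qx = ≤-by-difference _ refl (proj₁ (blockProb-difference l pry prx y≤x))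

  blockProb-above : ∀ l {a η γ} → γ ≤ 1ℚ - a → (1ℚ - η) ^ l < γ → a < blockProb l η
  blockProb-above l {a} {η} {γ} γ≤1-a u<γ = <-by-difference ((γ - (1ℚ - η) ^ l) + ((1ℚ - a) - γ))
    (solve 3 (λ a γ u → (con 1ℚ :- u) :- a := (γ :- u) :+ ((con 1ℚ :- a) :- γ)) refl a γ ((1ℚ - η) ^ l))
    (+-pos (p<q⇒0<q-p u<γ) (p≤q⇒0≤q-p γ≤1-a))

  blockProb-Prob : ∀ l {p} → Prob p → Prob (blockProb l p)
  blockProb-Prob l pr = Prob-complement (Prob-^ l (Prob-complement pr))

module AlternatingSequences where

  open import Defs hiding (sym)
  open RationalFacts
  open import Data.Bool using (true; false; not; if_then_else_; T)
  open import Data.Nat as ℕ using (ℕ; zero; suc; _∸_; z≤n; s≤s)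
  import Data.Nat.Properties as ℕ
  open import Data.Nat.Divisibility using (_∣_; divides)
  open import Data.Rational
  open import Data.Rational.Properties
  open import Data.Product using (_×_; _,_)
  open import Data.Sum using (inj₁; inj₂)
  open import Data.Empty using (⊥-elim)
  open import Function using (_∘_)
  open import Relation.Binary.PropositionalEquality using (_≡_; refl; sym; trans; cong; subst; subst₂)

  isEven-suc : ∀ n → isEven (suc n) ≡ not (isEven n)
  isEven-suc zero          = refl
  isEven-suc (suc zero)    = refl
  isEven-suc (suc (suc n)) = isEven-suc n

  2∣⇒isEven : ∀ {k} → 2 ∣ k → isEven k ≡ true
  2∣⇒isEven (divides q refl) = isEven-*2 q
    where
    isEven-*2 : ∀ q → isEven (q ℕ.* 2) ≡ true
    isEven-*2 zero    = refl
    isEven-*2 (suc q) = isEven-*2 q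

  IncreasingIn01-bounds : ∀ {k α} → IncreasingIn01 k α → ∀ i → i ℕ.< k → 0ℚ < α i × α i < 1ℚ
  IncreasingIn01-bounds {k} {α} (0<α₀ , increasing , last<1) i i<k =
    above-0 i i<k , below-1 (k ∸ suc i) i (ℕ.m+[n∸m]≡n i<k)
    where
    above-0 : ∀ i → i ℕ.< k → 0ℚ < α i
    above-0 zero    _   = 0<α₀
    above-0 (suc i) i<k = <-trans (above-0 i (ℕ.<-trans (ℕ.n<1+n i) i<k)) (increasing i i<k)
    below-1 : ∀ d i → suc i ℕ.+ d ≡ k → α i < 1ℚ
    below-1 zero    i eq = last<1 i (trans (cong suc (sym (ℕ.+-identityʳ i))) eq)
    below-1 (suc d) i eq = <-trans (increasing i (subst (suc i ℕ.<_) eq′ (s≤s (s≤s (ℕ.m≤m+n i d)))))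
                                   (below-1 d (suc i) eq′)
      where
      eq′ : suc (suc i) ℕ.+ d ≡ k
      eq′ = trans (cong suc (sym (ℕ.+-suc i d))) eq

  -- The jump from β i to β (suc i), oriented so that it is positive along an alternating sequence.
  gap : (ℕ → ℚ) → ℕ → ℚ
  gap β i = if isEven i then β i - β (suc i) else β (suc i) - β i

  Alternating⇒gap-pos : ∀ {k β} → Alternating k β → ∀ i → suc i ℕ.< k → 0ℚ < gap β i
  Alternating⇒gap-pos (_ , alternates) i i<k with isEven i | alternates i i<k
  ... | true  | β₊<β = p<q⇒0<q-p β₊<β
  ... | false | β<β₊ = p<q⇒0<q-p β<β₊

  Alternating-perturb : ∀ {k β h ε} → Alternating k β → (∀ i → suc i ℕ.< k → ε + ε < gap β i) →
                        (∀ i → i ℕ.< k → ∣ h i - β i ∣ ≤ ε) → 0ℚ < h 0 → Alternating k h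
  Alternating-perturb {k} {β} {h} β-alt wide close 0<h₀ = 0<h₀ , alternates
    where
    alternates : ∀ i → suc i ℕ.< k → if isEven i then h (suc i) < h i else h i < h (suc i)
    alternates i i<k with isEven i | wide i i<k
    ... | true  | w = separated (close i (ℕ.<-trans (ℕ.n<1+n i) i<k)) (close (suc i) i<k) w
    ... | false | w = separated (close (suc i) i<k) (close i (ℕ.<-trans (ℕ.n<1+n i) i<k)) w

  snoc : ℕ → (ℕ → ℚ) → ℚ → ℕ → ℚ
  snoc k f r i = if i ℕ.<ᵇ k then f i else r

  snoc-< : ∀ {k} f r {i} → i ℕ.< k → snoc k f r i ≡ f i
  snoc-< {k} f r {i} i<k with i ℕ.<ᵇ k | ℕ.<⇒<ᵇ i<k
  ... | true | _ = refl

  snoc-last : ∀ k f r → snoc k f r k ≡ r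
  snoc-last k f r with k ℕ.<ᵇ k in eq
  ... | true  = ⊥-elim (ℕ.<-irrefl refl (ℕ.<ᵇ⇒< k k (subst T (sym eq) _)))
  ... | false = refl

  IncreasingIn01-snoc : ∀ m {f r} → IncreasingIn01 (suc m) f → f m < r → r < 1ℚ →
                        IncreasingIn01 (suc (suc m)) (snoc (suc m) f r)
  IncreasingIn01-snoc m {f} {r} (0<f₀ , increasing , _) fₘ<r r<1 =
    subst (0ℚ <_) (sym (snoc-< {suc m} f r (s≤s z≤n))) 0<f₀ , increasing′ ,
    λ { i refl → subst (_< 1ℚ) (sym (snoc-last (suc m) f r)) r<1 }
    where
    increasing′ : ∀ i → suc i ℕ.< suc (suc m) → snoc (suc m) f r i < snoc (suc m) f r (suc i)
    increasing′ i i<2+m with ℕ.m<1+n⇒m<n∨m≡n i<2+m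
    ... | inj₁ i<1+m = subst₂ _<_ (sym (snoc-< f r (ℕ.<-trans (ℕ.n<1+n i) i<1+m))) (sym (snoc-< f r i<1+m))
                              (increasing i i<1+m)
    ... | inj₂ refl  = subst₂ _<_ (sym (snoc-< f r (ℕ.n<1+n m))) (sym (snoc-last (suc m) f r)) fₘ<r

  Alternating-snoc : ∀ m (g : ℚ → ℚ) {f r} → isEven m ≡ false → Alternating (suc m) (g ∘ f) → g (f m) < g r →
                     Alternating (suc (suc m)) (g ∘ snoc (suc m) f r)
  Alternating-snoc m g {f} {r} m-odd (0<g₀ , alternates) gfₘ<gr =
    subst (λ x → 0ℚ < g x) (sym (snoc-< {suc m} f r (s≤s z≤n))) 0<g₀ , alternates′
    where
    gs : ℕ → ℚ
    gs = g ∘ snoc (suc m) f r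
    alternates′ : ∀ i → suc i ℕ.< suc (suc m) → if isEven i then gs (suc i) < gs i else gs i < gs (suc i)
    alternates′ i i<2+m with ℕ.m<1+n⇒m<n∨m≡n i<2+m
    ... | inj₁ i<1+m = subst₂ (λ x y → if isEven i then g y < g x else g x < g y)
                              (sym (snoc-< f r (ℕ.<-trans (ℕ.n<1+n i) i<1+m))) (sym (snoc-< f r i<1+m)) (alternates i i<1+m)
    ... | inj₂ refl  = subst (λ b → if b then gs (suc m) < gs m else gs m < gs (suc m)) (sym m-odd)
                             (subst₂ (λ x y → g x < g y) (sym (snoc-< f r (ℕ.n<1+n m))) (sym (snoc-last (suc m) f r)) gfₘ<gr)

module Extension where

  open import Defs hiding (sym)
  open ReliabilityFormulas
  open RationalFacts
  open ReliabilityBounds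
  open BlockProbability
  open AlternatingSequences
  open import Data.Bool using (true; not; if_then_else_)
  open import Data.Nat as ℕ using (ℕ; suc; z≤n; s≤s)
  import Data.Nat.Properties as ℕ
  open import Data.Rational
  open import Data.Rational.Properties
  open import Data.Rational.Solver using (module +-*-Solver)
  open import Data.Product using (Σ; _×_; _,_; proj₁; proj₂)
  open import Function using (_∘_)
  open import Relation.Binary.PropositionalEquality using (_≡_; refl; sym; trans; cong; subst)
  open +-*-Solver

  -- η bounds both the apex term p i ≤ η and the Lipschitz error K * E ≤ η, so each N(H; p i) lies within
  -- 2η of β i, less than half of every gap of β.
  module Perturbation {n} (G : Graph n) (k₂ : ℕ) (k₂-even : isEven k₂ ≡ true) (α : ℕ → ℚ)
    (α-inc : IncreasingIn01 (suc (suc k₂)) α) (β-alt : Alternating (suc (suc k₂)) (nodeRel G ∘ α))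
    {K : ℚ} (0≤K : 0ℚ ≤ K)
    (lipschitz : ∀ {x y} → Prob x → Prob y → ∣ nodeRel G x - nodeRel G y ∣ ≤ K * ∣ x - y ∣)
    {η : ℚ} (0<η : 0ℚ < η) (η<1 : η < 1ℚ)
    (4η<gap : ∀ i → suc i ℕ.< suc (suc k₂) → (η + η) + (η + η) < gap (nodeRel G ∘ α) i)
    {E : ℚ} (KE≤η : K * E ≤ η) (E≤Δα : ∀ i → suc i ℕ.< suc (suc k₂) → E ≤ α (suc i) - α i)
    (l : ℕ) {p : ℕ → ℚ} (overshoot : ∀ i → i ℕ.< suc (suc k₂) → Overshoot l η E (α i) (p i))
    where

    open Overshoot

    k : ℕ
    k = suc (suc k₂)

    last : ℕ
    last = suc k₂

    last<k : last ℕ.< k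
    last<k = ℕ.≤-refl

    β : ℕ → ℚ
    β = nodeRel G ∘ α

    NH : ℚ → ℚ
    NH = nodeRel (coneK1 (lexK G l))

    p-Prob : ∀ i → i ℕ.< k → Prob (p i)
    p-Prob i i<k = <⇒≤ (0<p (overshoot i i<k)) , ≤-trans (p≤η (overshoot i i<k)) (<⇒≤ η<1)

    α-Prob : ∀ i → i ℕ.< k → Prob (α i)
    α-Prob i i<k = <⇒≤ (proj₁ (IncreasingIn01-bounds α-inc i i<k)) , <⇒≤ (proj₂ (IncreasingIn01-bounds α-inc i i<k))

    q-near-α : ∀ i → i ℕ.< k → ∣ blockProb l (p i) - α i ∣ ≤ E
    q-near-α i i<k = subst (_≤ E) (sym (0≤p⇒∣p∣≡p (p≤q⇒0≤q-p (<⇒≤ (α<q (overshoot i i<k))))))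
      (≤-by-difference ((α i + E) - blockProb l (p i))
        (solve 3 (λ a e x → e :- (x :- a) := (a :+ e) :- x) refl (α i) E (blockProb l (p i)))
        (p≤q⇒0≤q-p (q≤α+E (overshoot i i<k))))

    NH-near-β : ∀ i → i ℕ.< k → ∣ NH (p i) - β i ∣ ≤ η + η
    NH-near-β i i<k = begin
      ∣ NH (p i) - β i ∣                                  ≤⟨ coneK1-perturbation (lexK G l) (β i) (p-Prob i i<k) ⟩
      p i + ∣ nodeRel (lexK G l) (p i) - β i ∣            ≡⟨ cong (λ z → p i + ∣ z - β i ∣) (nodeRel-lexK G l (p i)) ⟩
      p i + ∣ nodeRel G (blockProb l (p i)) - β i ∣       ≤⟨ +-mono-≤ (p≤η (overshoot i i<k))
                                                              (lipschitz (blockProb-Prob l (p-Prob i i<k)) (α-Prob i i<k)) ⟩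
      η + K * ∣ blockProb l (p i) - α i ∣                 ≤⟨ +-monoʳ-≤ η (*-monoˡ-≤-nonNeg K {{nonNegative 0≤K}} (q-near-α i i<k)) ⟩
      η + K * E                                           ≤⟨ +-monoʳ-≤ η KE≤η ⟩
      η + η ∎
      where open ≤-Reasoning

    p-increasing : IncreasingIn01 k p
    p-increasing = 0<p (overshoot 0 (s≤s z≤n)) , increasing , λ { i refl → ≤-<-trans (p≤η (overshoot i last<k)) η<1 }
      where
      increasing : ∀ i → suc i ℕ.< k → p i < p (suc i)
      increasing i i₊<k = blockProb-cancel-< l (p-Prob i i<k) (p-Prob (suc i) i₊<k)
        (≤-<-trans (q≤α+E (overshoot i i<k)) (≤-<-trans α+E≤α₊ (α<q (overshoot (suc i) i₊<k))))
        where
        i<k : i ℕ.< k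
        i<k = ℕ.<-trans (ℕ.n<1+n i) i₊<k
        α+E≤α₊ : α i + E ≤ α (suc i)
        α+E≤α₊ = ≤-by-difference ((α (suc i) - α i) - E)
          (solve 3 (λ a a₊ e → a₊ :- (a :+ e) := (a₊ :- a) :- e) refl (α i) (α (suc i)) E)
          (p≤q⇒0≤q-p (E≤Δα i i₊<k))

    p-alternating : Alternating k (NH ∘ p)
    p-alternating = Alternating-perturb β-alt 4η<gap NH-near-β
      (<-≤-trans (0<p (overshoot 0 (s≤s z≤n))) (coneK1-apex-bound (lexK G l) (p-Prob 0 (s≤s z≤n))))

    -- Since β last < β k₂ ≤ 1, the value 1 is separated from β last like β k₂ is.
    NH-last<1 : NH (p last) < 1ℚ
    NH-last<1 = separated {x = 1ℚ} {a = 1ℚ}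
      (subst (_≤ η + η) (sym (cong ∣_∣ (+-inverseʳ 1ℚ))) (<⇒≤ (+-pos 0<η (<⇒≤ 0<η))))
      (NH-near-β last last<k)
      (<-≤-trans (subst ((η + η) + (η + η) <_) gap-k₂ (4η<gap k₂ last<k))
                 (+-monoˡ-≤ (- β last) (proj₂ (nodeRel-Prob G (α-Prob k₂ (ℕ.<-trans (ℕ.n<1+n k₂) last<k))))))
      where
      gap-k₂ : gap β k₂ ≡ β k₂ - β last
      gap-k₂ = cong (λ b → if b then β k₂ - β last else β last - β k₂) k₂-even

    extension : Σ (ℕ → ℚ) λ α′ → IncreasingIn01 (suc k) α′ × Alternating (suc k) (NH ∘ α′)
    extension =
      let (r , NH-last<r , r<1) = <-dense NH-last<1
          p-last≤NH : p last ≤ NH (p last)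
          p-last≤NH = coneK1-apex-bound (lexK G l) (p-Prob last last<k)
          0<r : 0ℚ < r
          0<r = ≤-<-trans (≤-trans (proj₁ (p-Prob last last<k)) p-last≤NH) NH-last<r
      in snoc k p r ,
         IncreasingIn01-snoc last p-increasing (≤-<-trans p-last≤NH NH-last<r) r<1 ,
         Alternating-snoc last NH (trans (isEven-suc k₂) (cong not k₂-even)) p-alternating
           (<-≤-trans NH-last<r (coneK1-apex-bound (lexK G l) (<⇒≤ 0<r , <⇒≤ r<1)))

  -- γ keeps blockProb l (p i) below α (suc i), and γ′ makes blockProb l η exceed every α i.
  extend-alternation : ∀ {n} (G : Graph n) k₂ → isEven k₂ ≡ true → (α : ℕ → ℚ) →
    IncreasingIn01 (suc (suc k₂)) α → Alternating (suc (suc k₂)) (λ i → nodeRel G (α i)) →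
    Σ ℕ (λ l → 0 ℕ.< l × Σ (ℕ → ℚ) (λ α′ → IncreasingIn01 (suc (suc (suc k₂))) α′ ×
      Alternating (suc (suc (suc k₂))) (λ i → nodeRel (coneK1 (lexK G l)) (α′ i))))
  extend-alternation G k₂ k₂-even α α-inc β-alt =
    let (δ , 0<δ , δ≤1 , δ≤gap)   = positiveLowerBound (suc k₂) (gap β)
                                      (λ i i<k → Alternating⇒gap-pos β-alt i (s≤s i<k))
        (γ , 0<γ , _ , γ≤Δα)      = positiveLowerBound (suc k₂) (λ i → α (suc i) - α i)
                                      (λ i i<k → p<q⇒0<q-p (proj₁ (proj₂ α-inc) i (s≤s i<k)))
        (γ′ , 0<γ′ , _ , γ′≤1-α)  = positiveLowerBound (suc (suc k₂)) (λ i → 1ℚ - α i)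
                                      (λ i i<k → p<q⇒0<q-p (proj₂ (IncreasingIn01-bounds α-inc i i<k)))
        (K , 0≤K , lipschitz)     = nodeRel-lipschitz G
        (η , 0<η , η<1 , 4η<δ)    = ∃-fourfold-below 0<δ δ≤1
        (E₀ , 0<E₀ , KE₀≤η)       = ∃-small-multiple 0≤K 0<η
        (l₀ , shrunk)             = ^-eventually-< 0<η (<⇒≤ η<1) 0<γ′
        E : ℚ
        E                         = E₀ ⊓ γ
        (p , overshoot)           = bounded-choice 0ℚ (suc (suc k₂)) λ i i<k →
          blockProb-overshoot (suc l₀) 0<η (<⇒≤ η<1) (<⇒≤ (proj₁ (IncreasingIn01-bounds α-inc i i<k)))
            (blockProb-above (suc l₀) {η = η} (γ′≤1-α i i<k) shrunk) (⊓-pos 0<E₀ 0<γ)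
    in suc l₀ , s≤s z≤n , Perturbation.extension G k₂ k₂-even α α-inc β-alt {K} 0≤K lipschitz {η} 0<η η<1
         (λ i i<k → <-≤-trans 4η<δ (δ≤gap i (ℕ.≤-pred i<k)))
         {E} (≤-trans (*-monoˡ-≤-nonNeg K {{nonNegative 0≤K}} (p⊓q≤p E₀ γ)) KE₀≤η)
         (λ i i<k → ≤-trans (p⊓q≤q E₀ γ) (γ≤Δα i (ℕ.≤-pred i<k)))
         (suc l₀) overshoot
    where
    β : ℕ → ℚ
    β i = nodeRel G (α i)

open import Defs
open import Data.Nat using (ℕ; zero; suc; _<_)
open import Data.Nat.Divisibility using (_∣_)
open import Data.Product using (Σ; _×_)
open import Data.Rational using (ℚ)
open AlternatingSequences using (2∣⇒isEven)
open Extension using (extend-alternation)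

mainTheorem4 : ∀ {n : ℕ} (G : Graph n) (k : ℕ) → 0 < k → 2 ∣ k → Disconnected G →
    (α : ℕ → ℚ) → IncreasingIn01 k α → Alternating k (λ i → nodeRel G (α i)) →
    Σ ℕ (λ l → 0 < l × Σ (ℕ → ℚ) (λ α′ → IncreasingIn01 (suc k) α′ ×
      Alternating (suc k) (λ i → nodeRel (coneK1 (lexK G l)) (α′ i))))
mainTheorem4 G zero           ()
mainTheorem4 G (suc zero)     _ 2∣1 with 2∣⇒isEven 2∣1
... | ()
mainTheorem4 G (suc (suc k₂)) _ 2∣k _ = extend-alternation G k₂ (2∣⇒isEven 2∣k)
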